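{- Let $\ell$ be an odd prime. The set of indices $[\operatorname{GL}_2(\mathbb{Z}/\ell\mathbb{Z}):G]$ of subgroups $G\le\operatorname{GL}_2(\mathbb{Z}/\ell\mathbb{Z})$ that belong to $C_s(\ell)$ is the set of positive integers $n$ such that $\ell(\ell+1)\mid n$ and $n\mid \ell(\ell+1)(\ell-1)^2/q$ for some prime $q$ dividing $\ell-1$.
   Context: $C_s(\ell)$ is the group of invertible diagonal matrices in $\operatorname{GL}_2(\mathbb{Z}/\ell\mathbb{Z})$ and $Z(\ell)$ the scalar matrices. A subgroup belongs to $C_s(\ell)$ if it is conjugate in $\operatorname{GL}_2(\mathbb{Z}/\ell\mathbb{Z})$ to a subgroup of $C_s(\ell)$ but not to a subgroup of $Z(\ell)$. -}

module Defs where

open import Data.Nat using (ℕ; zero; suc; _+_; _*_; _∸_; _/_; NonZero; nonTrivial⇒nonZero)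
open import Data.Nat.DivMod using (_mod_)
open import Data.Nat.Primality using (Prime; prime)
open import Data.Fin using (Fin; toℕ)
open import Data.Bool using (Bool; true; false; if_then_else_)
open import Data.List using (List; allFin; cartesianProductWith; map)
open import Data.Nat.ListAction using (sum)
open import Data.Product using (Σ; ∃; _×_; _,_)
open import Relation.Binary.PropositionalEquality using (_≡_; _≢_)
open import Relation.Nullary using (¬_; Dec; yes; no)

-- 2x2 matrices over Z/ℓZ, entries (a b ; c d), with Z/ℓZ represented by Fin ℓ
record Mat (ℓ : ℕ) : Set where
  constructor mat
  field a b c d : Fin ℓ

module _ (ℓ : ℕ) .{{_ : NonZero ℓ}} where

  _+ℓ_ _*ℓ_ : Fin ℓ → Fin ℓ → Fin ℓ
  x +ℓ y = (toℕ x + toℕ y) mod ℓ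
  x *ℓ y = (toℕ x * toℕ y) mod ℓ

  -ℓ_ : Fin ℓ → Fin ℓ
  -ℓ x = (ℓ ∸ toℕ x) mod ℓ

  0ℓ 1ℓ : Fin ℓ
  0ℓ = 0 mod ℓ
  1ℓ = 1 mod ℓ

  infixl 7 _·_
  _·_ : Mat ℓ → Mat ℓ → Mat ℓ
  mat a b c d · mat a' b' c' d' =
    mat ((a *ℓ a') +ℓ (b *ℓ c')) ((a *ℓ b') +ℓ (b *ℓ d'))
        ((c *ℓ a') +ℓ (d *ℓ c')) ((c *ℓ b') +ℓ (d *ℓ d'))

  I : Mat ℓ
  I = mat 1ℓ 0ℓ 0ℓ 1ℓ

  det : Mat ℓ → Fin ℓ
  det (mat a b c d) = (a *ℓ d) +ℓ (-ℓ (b *ℓ c))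

  -- membership in GL_2(Z/ℓZ): determinant is a unit (ℓ prime: nonzero)
  isGL : Mat ℓ → Bool
  isGL M with toℕ (det M)
  ... | zero = false
  ... | suc _ = true

  -- diagonal matrices (C_s(ℓ) = invertible diagonal matrices) and scalar matrices (Z(ℓ))
  IsDiagonal : Mat ℓ → Set
  IsDiagonal (mat a b c d) = (b ≡ 0ℓ) × (c ≡ 0ℓ)

  IsScalar : Mat ℓ → Set
  IsScalar (mat a b c d) = (b ≡ 0ℓ) × (c ≡ 0ℓ) × (a ≡ d)

  allMats : List (Mat ℓ)
  allMats = cartesianProductWith (λ f g → f g) (cartesianProductWith (λ f g → f g)
              (cartesianProductWith mat (allFin ℓ) (allFin ℓ)) (allFin ℓ)) (allFin ℓ)

  card : (Mat ℓ → Bool) → ℕ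
  card S = sum (map (λ M → if S M then 1 else 0) allMats)

  record Subgroup : Set where
    field
      mem     : Mat ℓ → Bool
      ⊆GL     : ∀ M → mem M ≡ true → isGL M ≡ true
      has-I   : mem I ≡ true
      closed· : ∀ M N → mem M ≡ true → mem N ≡ true → mem (M · N) ≡ true
      closed⁻¹ : ∀ M → mem M ≡ true → Σ (Mat ℓ) λ N → (mem N ≡ true) × (M · N ≡ I)

  open Subgroup public

  HasIndex : Subgroup → ℕ → Set
  HasIndex G n = n * card (mem G) ≡ card isGL

  -- G is conjugate in GL_2 to a subgroup of the matrices satisfying P
  -- (conjugation by P with inverse Q, i.e. M ↦ Q M P = P⁻¹ M P)
  ConjugateInto : (Mat ℓ → Set) → Subgroup → Set
  ConjugateInto Pr G =
    Σ (Mat ℓ) λ P → Σ (Mat ℓ) λ Q →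
      (isGL P ≡ true) × (P · Q ≡ I) × (Q · P ≡ I) ×
      (∀ M → mem G M ≡ true → Pr (Q · M · P))

  BelongsToCs : Subgroup → Set
  BelongsToCs G = ConjugateInto IsDiagonal G × ¬ ConjugateInto IsScalar G

_/ₚ_ : ℕ → (q : ℕ) → Prime q → ℕ
(m /ₚ q) (prime _) = _/_ m q {{nonTrivial⇒nonZero q}}

module Submission where

open import Defs
open import Data.Nat using (ℕ; _+_; _*_; _∸_; _^_; _<_; NonZero)
open import Data.Nat.Divisibility using (_∣_)
open import Data.Nat.Primality using (Prime)
open import Data.Product using (Σ; ∃; _×_)
open import Function.Bundles using (_⇔_)
open import Relation.Binary.PropositionalEquality using (_≢_)

-- Write L = ℓ - 1.  The proof has three ingredients.
--   * |GL₂(Z/ℓZ)| = ℓ (ℓ + 1) L², by counting singular matrices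
--     (GeneralLinear).
--   * If G is conjugate to a group of diagonal matrices, G is isomorphic to a
--     subgroup of the torus (Z/ℓZ)^× × (Z/ℓZ)^×, so |G| divides L² (Lagrange,
--     Cosets); G is not conjugate into the scalars, so |G| ≠ 1 (CsSubgroups).
--     Conversely, for a, b ∣ L with a b ≥ 2 the group μₐ × μ_b of diagonal
--     matrices whose entries are roots of unity has order a b (there are exactly
--     a a-th roots of unity, Polynomials) and is not conjugate into the scalars.
--   * Elementary arithmetic (IndexArithmetic): the numbers N / c with N = A L²,
--     c ∣ L², c ≠ 1 are exactly the positive multiples n of A that divide N / q
--     for some prime q ∣ L, and every divisor of L² is a product of two
--     divisors of L.

module ModularArithmetic where

  open import Defs
  open import Data.Nat as ℕ using (ℕ; NonZero; _%_)
  import Data.Nat.Properties as ℕ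
  open import Data.Nat.DivMod
  open import Data.Fin using (Fin; toℕ)
  open import Data.Fin.Properties using (toℕ-injective; toℕ-fromℕ<; toℕ<n)
  open import Data.Product using (_,_)
  open import Relation.Binary.PropositionalEquality
  open import Algebra.Bundles using (CommutativeRing)
  open import Data.Maybe using (Maybe; just; nothing)
  open import Relation.Nullary using (yes; no)
  open ≡-Reasoning

  module ZMod (p : ℕ) .{{_ : NonZero p}} where

    F : Set
    F = Fin p

    infixl 6 _+'_
    infixl 7 _*'_
    _+'_ _*'_ : F → F → F
    _+'_ = _+ℓ_ p
    _*'_ = _*ℓ_ p

    -'_ : F → F
    -'_ = -ℓ_ p

    0' 1' : F
    0' = 0ℓ p
    1' = 1ℓ p

    -- reduction ℕ → Z/pZ; by definition x +' y = reduce (toℕ x + toℕ y), etc.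
    reduce : ℕ → F
    reduce m = m mod p

    toℕ-reduce : ∀ m → toℕ (reduce m) ≡ m % p
    toℕ-reduce m = toℕ-fromℕ< _

    reduce-cong : ∀ {m n} → m % p ≡ n % p → reduce m ≡ reduce n
    reduce-cong {m} {n} e = toℕ-injective (trans (toℕ-reduce m) (trans e (sym (toℕ-reduce n))))

    reduce-toℕ : ∀ x → reduce (toℕ x) ≡ x
    reduce-toℕ x = toℕ-injective (trans (toℕ-reduce (toℕ x)) (m<n⇒m%n≡m (toℕ<n x)))

    reduce-+ : ∀ m n → reduce (m ℕ.+ n) ≡ reduce m +' reduce n
    reduce-+ m n = reduce-cong (begin
      (m ℕ.+ n) % p                                   ≡⟨ %-distribˡ-+ m n p ⟩
      (m % p ℕ.+ n % p) % p                           ≡⟨ cong₂ (λ u v → (u ℕ.+ v) % p) (sym (toℕ-reduce m)) (sym (toℕ-reduce n)) ⟩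
      (toℕ (reduce m) ℕ.+ toℕ (reduce n)) % p         ∎)

    reduce-* : ∀ m n → reduce (m ℕ.* n) ≡ reduce m *' reduce n
    reduce-* m n = reduce-cong (begin
      (m ℕ.* n) % p                                   ≡⟨ %-distribˡ-* m n p ⟩
      (m % p ℕ.* (n % p)) % p                         ≡⟨ cong₂ (λ u v → (u ℕ.* v) % p) (sym (toℕ-reduce m)) (sym (toℕ-reduce n)) ⟩
      (toℕ (reduce m) ℕ.* toℕ (reduce n)) % p         ∎)

    reduce-multiple : ∀ k → reduce (k ℕ.* p) ≡ 0'
    reduce-multiple k = reduce-cong (trans (m*n%n≡0 k p) (sym (m<n⇒m%n≡m (ℕ.>-nonZero⁻¹ p))))

    absorbˡ-+ : ∀ m n → reduce (toℕ (reduce m) ℕ.+ n) ≡ reduce (m ℕ.+ n)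
    absorbˡ-+ m n = trans (reduce-+ _ n) (trans (cong (_+' reduce n) (reduce-toℕ (reduce m))) (sym (reduce-+ m n)))

    absorbʳ-+ : ∀ m n → reduce (m ℕ.+ toℕ (reduce n)) ≡ reduce (m ℕ.+ n)
    absorbʳ-+ m n = trans (reduce-+ m _) (trans (cong (reduce m +'_) (reduce-toℕ (reduce n))) (sym (reduce-+ m n)))

    absorbˡ-* : ∀ m n → reduce (toℕ (reduce m) ℕ.* n) ≡ reduce (m ℕ.* n)
    absorbˡ-* m n = trans (reduce-* _ n) (trans (cong (_*' reduce n) (reduce-toℕ (reduce m))) (sym (reduce-* m n)))

    absorbʳ-* : ∀ m n → reduce (m ℕ.* toℕ (reduce n)) ≡ reduce (m ℕ.* n)
    absorbʳ-* m n = trans (reduce-* m _) (trans (cong (reduce m *'_) (reduce-toℕ (reduce n))) (sym (reduce-* m n)))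

    +-assoc : ∀ x y z → (x +' y) +' z ≡ x +' (y +' z)
    +-assoc x y z = begin
      reduce (toℕ (reduce (a ℕ.+ b)) ℕ.+ c)  ≡⟨ absorbˡ-+ (a ℕ.+ b) c ⟩
      reduce (a ℕ.+ b ℕ.+ c)                 ≡⟨ cong reduce (ℕ.+-assoc a b c) ⟩
      reduce (a ℕ.+ (b ℕ.+ c))               ≡⟨ absorbʳ-+ a (b ℕ.+ c) ⟨
      reduce (a ℕ.+ toℕ (reduce (b ℕ.+ c)))  ∎
      where
      a b c : ℕ
      a = toℕ x; b = toℕ y; c = toℕ z

    *-assoc : ∀ x y z → (x *' y) *' z ≡ x *' (y *' z)
    *-assoc x y z = begin
      reduce (toℕ (reduce (a ℕ.* b)) ℕ.* c)  ≡⟨ absorbˡ-* (a ℕ.* b) c ⟩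
      reduce (a ℕ.* b ℕ.* c)                 ≡⟨ cong reduce (ℕ.*-assoc a b c) ⟩
      reduce (a ℕ.* (b ℕ.* c))               ≡⟨ absorbʳ-* a (b ℕ.* c) ⟨
      reduce (a ℕ.* toℕ (reduce (b ℕ.* c)))  ∎
      where
      a b c : ℕ
      a = toℕ x; b = toℕ y; c = toℕ z

    +-comm : ∀ x y → x +' y ≡ y +' x
    +-comm x y = cong reduce (ℕ.+-comm (toℕ x) (toℕ y))

    *-comm : ∀ x y → x *' y ≡ y *' x
    *-comm x y = cong reduce (ℕ.*-comm (toℕ x) (toℕ y))

    +-identityˡ : ∀ x → 0' +' x ≡ x
    +-identityˡ x = trans (absorbˡ-+ 0 (toℕ x)) (reduce-toℕ x)

    +-identityʳ : ∀ x → x +' 0' ≡ x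
    +-identityʳ x = trans (+-comm x 0') (+-identityˡ x)

    *-identityˡ : ∀ x → 1' *' x ≡ x
    *-identityˡ x = trans (absorbˡ-* 1 (toℕ x)) (trans (cong reduce (ℕ.*-identityˡ (toℕ x))) (reduce-toℕ x))

    *-identityʳ : ∀ x → x *' 1' ≡ x
    *-identityʳ x = trans (*-comm x 1') (*-identityˡ x)

    distribˡ : ∀ x y z → x *' (y +' z) ≡ x *' y +' x *' z
    distribˡ x y z = begin
      reduce (a ℕ.* toℕ (reduce (b ℕ.+ c)))  ≡⟨ absorbʳ-* a (b ℕ.+ c) ⟩
      reduce (a ℕ.* (b ℕ.+ c))               ≡⟨ cong reduce (ℕ.*-distribˡ-+ a b c) ⟩
      reduce (a ℕ.* b ℕ.+ a ℕ.* c)           ≡⟨ reduce-+ (a ℕ.* b) (a ℕ.* c) ⟩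
      x *' y +' x *' z                       ∎
      where
      a b c : ℕ
      a = toℕ x; b = toℕ y; c = toℕ z

    distribʳ : ∀ x y z → (y +' z) *' x ≡ y *' x +' z *' x
    distribʳ x y z = trans (*-comm _ x) (trans (distribˡ x y z) (cong₂ _+'_ (*-comm x y) (*-comm x z)))

    -‿inverseʳ : ∀ x → x +' (-' x) ≡ 0'
    -‿inverseʳ x = begin
      reduce (a ℕ.+ toℕ (reduce (p ℕ.∸ a)))  ≡⟨ absorbʳ-+ a (p ℕ.∸ a) ⟩
      reduce (a ℕ.+ (p ℕ.∸ a))               ≡⟨ cong reduce (ℕ.m+[n∸m]≡n (ℕ.<⇒≤ (toℕ<n x))) ⟩
      reduce p                               ≡⟨ cong reduce (sym (ℕ.*-identityˡ p)) ⟩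
      reduce (1 ℕ.* p)                       ≡⟨ reduce-multiple 1 ⟩
      0'                                     ∎
      where
      a : ℕ
      a = toℕ x

    -‿inverseˡ : ∀ x → (-' x) +' x ≡ 0'
    -‿inverseˡ x = trans (+-comm (-' x) x) (-‿inverseʳ x)

    commutativeRing : CommutativeRing _ _
    commutativeRing = record
      { _≈_ = _≡_ ; _+_ = _+'_ ; _*_ = _*'_ ; -_ = -'_ ; 0# = 0' ; 1# = 1'
      ; isCommutativeRing = record
        { isRing = record
          { +-isAbelianGroup = record
            { isGroup = record
              { isMonoid = record
                { isSemigroup = record
                  { isMagma = record { isEquivalence = isEquivalence ; ∙-cong = cong₂ _+'_ }
                  ; assoc = +-assoc }
                ; identity = +-identityˡ , +-identityʳ }
              ; inverse = -‿inverseˡ , -‿inverseʳ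
              ; ⁻¹-cong = cong -'_ }
            ; comm = +-comm }
          ; *-cong = cong₂ _*'_
          ; *-assoc = *-assoc
          ; *-identity = *-identityˡ , *-identityʳ
          ; distrib = distribˡ , distribʳ }
        ; *-comm = *-comm } }

    open CommutativeRing commutativeRing public using (commutativeSemiring)
    open import Algebra.Properties.Semiring.Mult (CommutativeRing.semiring commutativeRing) using () renaming (_×_ to _×ᵤ_)

    -- equality of numerals decided on ℕ, the argument of the ring solver for Z/pZ
    -- (Algebra.Solver.Ring.NaturalCoefficients commutativeSemiring numeral-≟)
    numeral-≟ : ∀ m n → Maybe (m ×ᵤ 1' ≡ n ×ᵤ 1')
    numeral-≟ m n with m ℕ.≟ n
    ... | yes refl = just refl
    ... | no _ = nothing

module PrimeFields where

  open import Defs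
  open ModularArithmetic
  open import Data.Nat as ℕ using (ℕ; NonZero; _<_)
  import Data.Nat.Properties as ℕ
  open import Data.Nat.DivMod using (m<n⇒m%n≡m)
  open import Data.Nat.Divisibility using (_∣_; divides; m%n≡0⇒n∣m)
  open import Data.Nat.Primality using (Prime; prime⇒nonTrivial; euclidsLemma)
  open import Data.Nat.Coprimality using (prime⇒coprime; coprime-Bézout)
  open import Data.Nat.GCD using (module Bézout)
  open import Data.Fin as Fin using (toℕ)
  import Data.Fin.Properties as Fin
  open import Data.Fin.Properties using (toℕ<n)
  open import Data.Product using (Σ; _,_)
  open import Data.Sum using (_⊎_; inj₁; inj₂)
  open import Data.Empty using (⊥-elim)
  open import Relation.Binary.PropositionalEquality
  open import Relation.Nullary using (yes; no)
  open ≡-Reasoning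

  module PrimeField (p : ℕ) .{{_ : NonZero p}} (p-prime : Prime p) where

    open ZMod p public
    open import Algebra.Bundles using (CommutativeRing)
    open CommutativeRing commutativeRing public using (ring; zeroˡ; zeroʳ)
    open import Algebra.Properties.Ring ring public
      using (-‿involutive; +-inverseʳ-unique; -‿distribʳ-*; +-cancelʳ)
      renaming (x∙y⁻¹≈ε⇒x≈y to x-y≡0⇒x≡y; x≈y⇒x∙y⁻¹≈ε to x≡y⇒x-y≡0)

    1<p : 1 < p
    1<p = ℕ.nonTrivial⇒n>1 p {{prime⇒nonTrivial p-prime}}

    toℕ-0 : toℕ 0' ≡ 0
    toℕ-0 = trans (toℕ-reduce 0) (m<n⇒m%n≡m (ℕ.<-trans (ℕ.n<1+n 0) 1<p))

    1≢0 : 1' ≢ 0'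
    1≢0 e with trans (sym (trans (toℕ-reduce 1) (m<n⇒m%n≡m 1<p))) (trans (cong toℕ e) toℕ-0)
    ... | ()

    reduce≡0⇒∣ : ∀ m → reduce m ≡ 0' → p ∣ m
    reduce≡0⇒∣ m e = m%n≡0⇒n∣m m p (trans (sym (toℕ-reduce m)) (trans (cong toℕ e) toℕ-0))

    ∣⇒reduce≡0 : ∀ {m} → p ∣ m → reduce m ≡ 0'
    ∣⇒reduce≡0 (divides k refl) = reduce-multiple k

    -- Euclid's lemma, read in Z/pZ
    no-zero-divisors : ∀ x y → x *' y ≡ 0' → x ≡ 0' ⊎ y ≡ 0'
    no-zero-divisors x y e with euclidsLemma (toℕ x) (toℕ y) p-prime (reduce≡0⇒∣ _ e)
    ... | inj₁ p∣x = inj₁ (trans (sym (reduce-toℕ x)) (∣⇒reduce≡0 p∣x))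
    ... | inj₂ p∣y = inj₂ (trans (sym (reduce-toℕ y)) (∣⇒reduce≡0 p∣y))

    *-nonzero : ∀ x y → x ≢ 0' → y ≢ 0' → x *' y ≢ 0'
    *-nonzero x y x≢0 y≢0 e with no-zero-divisors x y e
    ... | inj₁ x≡0 = x≢0 x≡0
    ... | inj₂ y≡0 = y≢0 y≡0

    invertible⇒nonzero : ∀ x y → x *' y ≡ 1' → x ≢ 0'
    invertible⇒nonzero x y e x≡0 = 1≢0 (trans (sym e) (trans (cong (_*' y) x≡0) (zeroˡ y)))

    *-cancelʳ : ∀ a b c → c ≢ 0' → a *' c ≡ b *' c → a ≡ b
    *-cancelʳ a b c c≢0 e with no-zero-divisors (a +' -' b) c (begin
        (a +' -' b) *' c         ≡⟨ distribʳ c a (-' b) ⟩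
        a *' c +' -' b *' c      ≡⟨ cong (a *' c +'_) (trans (*-comm (-' b) c) (sym (-‿distribʳ-* c b))) ⟩
        a *' c +' -' (c *' b)    ≡⟨ cong₂ (λ u v → u +' -' v) e (*-comm c b) ⟩
        b *' c +' -' (b *' c)    ≡⟨ -‿inverseʳ (b *' c) ⟩
        0'                       ∎)
    ... | inj₁ a-b≡0 = x-y≡0⇒x≡y a b a-b≡0
    ... | inj₂ c≡0 = ⊥-elim (c≢0 c≡0)

    *-cancelʳ-⊎ : ∀ a b c → a *' c ≡ b *' c → a ≡ b ⊎ c ≡ 0'
    *-cancelʳ-⊎ a b c e with c Fin.≟ 0'
    ... | yes c≡0 = inj₂ c≡0
    ... | no c≢0 = inj₁ (*-cancelʳ a b c c≢0 e)

    -- every nonzero element is invertible (Bézout's identity for toℕ x and p)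
    inverse : ∀ x → x ≢ 0' → Σ F λ y → x *' y ≡ 1'
    inverse x x≢0 = from-Bézout (coprime-Bézout (prime⇒coprime p-prime {{nonzero}} (toℕ<n x)))
      where
      n : ℕ
      n = toℕ x
      nonzero : NonZero n
      nonzero = ℕ.≢-nonZero λ n≡0 → x≢0 (trans (sym (reduce-toℕ x)) (cong reduce n≡0))
      x*b : ∀ b → x *' reduce b ≡ reduce (b ℕ.* n)
      x*b b = trans (absorbʳ-* n b) (cong reduce (ℕ.*-comm n b))
      from-Bézout : Bézout.Identity 1 p n → Σ F λ y → x *' y ≡ 1'
      from-Bézout (Bézout.-+ a b 1+ap≡bn) = reduce b , (begin
        x *' reduce b                 ≡⟨ x*b b ⟩
        reduce (b ℕ.* n)              ≡⟨ cong reduce (sym 1+ap≡bn) ⟩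
        reduce (1 ℕ.+ a ℕ.* p)        ≡⟨ reduce-+ 1 (a ℕ.* p) ⟩
        1' +' reduce (a ℕ.* p)        ≡⟨ cong (1' +'_) (reduce-multiple a) ⟩
        1' +' 0'                      ≡⟨ +-identityʳ 1' ⟩
        1'                            ∎)
      from-Bézout (Bézout.+- a b 1+bn≡ap) = -' reduce b , (begin
        x *' -' reduce b              ≡⟨ -‿distribʳ-* x (reduce b) ⟨
        -' (x *' reduce b)            ≡⟨ cong -'_ (trans (x*b b) bn≡-1) ⟩
        -' (-' 1')                    ≡⟨ -‿involutive 1' ⟩
        1'                            ∎)
        where
        1+bn≡0 : 1' +' reduce (b ℕ.* n) ≡ 0'
        1+bn≡0 = trans (sym (reduce-+ 1 (b ℕ.* n))) (trans (cong reduce 1+bn≡ap) (reduce-multiple a))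
        bn≡-1 : reduce (b ℕ.* n) ≡ -' 1'
        bn≡-1 = +-inverseʳ-unique 1' _ 1+bn≡0

module FiniteSums where

  open import Data.Nat as ℕ using (ℕ; zero; suc; _+_; _*_; _≤_; _<_; z≤n; s≤s)
  import Data.Nat.Properties as ℕ
  open import Data.Fin as Fin using (Fin)
  import Data.Fin.Properties as Fin
  open import Data.Product using (Σ; ∃; _×_; _,_; proj₁; proj₂)
  open import Data.Bool using (Bool; true; false; _∧_; if_then_else_)
  open import Relation.Binary.PropositionalEquality
  open import Relation.Binary.Definitions using (DecidableEquality)
  open import Relation.Nullary using (Dec; yes; no; ¬_; does; _×-dec_)
  open import Data.Empty using (⊥-elim)
  open import Data.Sum using (_⊎_; inj₁; inj₂)
  open import Function using (_∘_)
  open import Algebra.Properties.CommutativeSemigroup ℕ.+-commutativeSemigroup using () renaming (interchange to +-interchange)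
  open ≡-Reasoning

  𝟙 : Bool → ℕ
  𝟙 b = if b then 1 else 0

  𝟙-∧ : ∀ x y → 𝟙 (x ∧ y) ≡ 𝟙 x * 𝟙 y
  𝟙-∧ true y = sym (ℕ.+-identityʳ (𝟙 y))
  𝟙-∧ false y = refl

  ∧-true : ∀ {x y} → x ∧ y ≡ true → x ≡ true × y ≡ true
  ∧-true {true} {true} _ = refl , refl

  χ : ∀ {P : Set} → Dec P → ℕ
  χ (yes _) = 1
  χ (no _) = 0

  𝟙-does : ∀ {P : Set} (d : Dec P) → 𝟙 (does d) ≡ χ d
  𝟙-does (yes _) = refl
  𝟙-does (no _) = refl

  χ-yes : ∀ {P : Set} (d : Dec P) → P → χ d ≡ 1
  χ-yes (yes _) _ = refl
  χ-yes (no ¬p) p = ⊥-elim (¬p p)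

  χ-no : ∀ {P : Set} (d : Dec P) → ¬ P → χ d ≡ 0
  χ-no (yes p) ¬p = ⊥-elim (¬p p)
  χ-no (no _) _ = refl

  χ-≤1 : ∀ {P : Set} (d : Dec P) → χ d ≤ 1
  χ-≤1 (yes _) = s≤s z≤n
  χ-≤1 (no _) = z≤n

  does⇒ : ∀ {P : Set} (d : Dec P) → does d ≡ true → P
  does⇒ (yes p) _ = p

  χ-×-dec : ∀ {P Q : Set} (p : Dec P) (q : Dec Q) → χ (p ×-dec q) ≡ χ p * χ q
  χ-×-dec (yes _) (yes _) = refl
  χ-×-dec (yes _) (no _) = refl
  χ-×-dec (no _) _ = refl

  χ-cover : ∀ {P Q R : Set} (p : Dec P) (q : Dec Q) (r : Dec R) → (¬ P → Q ⊎ R) → 1 ≤ χ p * 1 + (χ q + χ r)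
  χ-cover (yes _) q r _ = s≤s z≤n
  χ-cover (no ¬p) q r cover with cover ¬p
  ... | inj₁ x = ℕ.≤-trans (ℕ.≤-reflexive (sym (χ-yes q x))) (ℕ.m≤m+n (χ q) (χ r))
  ... | inj₂ y = ℕ.≤-trans (ℕ.≤-reflexive (sym (χ-yes r y))) (ℕ.m≤n+m (χ r) (χ q))

  χ-⇔ : ∀ {P Q : Set} (d : Dec P) (d' : Dec Q) → (P → Q) → (Q → P) → χ d ≡ χ d'
  χ-⇔ (yes _) (yes _) f g = refl
  χ-⇔ (no _) (no _) f g = refl
  χ-⇔ (yes p) (no ¬q) f g = ⊥-elim (¬q (f p))
  χ-⇔ (no ¬p) (yes q) f g = ⊥-elim (¬p (g q))

  record Additive {X : Set} (S : (X → ℕ) → ℕ) : Set where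
    field
      S-cong : ∀ {f g} → (∀ x → f x ≡ g x) → S f ≡ S g
      S-+ : ∀ f g → S (λ x → f x + g x) ≡ S f + S g
      S-0 : S (λ _ → 0) ≡ 0

  -- The fields are exactly the properties of finite sums used for counting:
  -- additivity, Fubini against any other additive sum, sifting by a Kronecker
  -- delta, monotonicity, and the existence of a positive term in a positive sum.
  record Enumerable (A : Set) : Set₁ where
    field
      ∑ : (A → ℕ) → ℕ
      additive : Additive ∑
      ∑-swap : ∀ {X : Set} (S : (X → ℕ) → ℕ) → Additive S → ∀ (f : A → X → ℕ) →
               ∑ (λ x → S (f x)) ≡ S (λ y → ∑ (λ x → f x y))
      _≟_ : DecidableEquality A
      ∑-δ : ∀ c (g : A → ℕ) → ∑ (λ x → χ (x ≟ c) * g x) ≡ g c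
      ∑-mono : ∀ {f g} → (∀ x → f x ≤ g x) → ∑ f ≤ ∑ g
      ∑-pos : ∀ f → 0 < ∑ f → ∃ λ x → 0 < f x
    open Additive additive public renaming (S-cong to ∑-cong; S-+ to ∑-+; S-0 to ∑-0)

    count : (A → Bool) → ℕ
    count P = ∑ (λ x → 𝟙 (P x))

    ∑-*ˡ : ∀ k (f : A → ℕ) → ∑ (λ x → k * f x) ≡ k * ∑ f
    ∑-*ˡ zero f = ∑-0
    ∑-*ˡ (suc k) f = trans (∑-+ f (λ x → k * f x)) (cong (∑ f +_) (∑-*ˡ k f))

    ∑-zero : ∀ (f : A → ℕ) → (∀ x → f x ≡ 0) → ∑ f ≡ 0
    ∑-zero f e = trans (∑-cong e) ∑-0

    ∑-single : ∀ (f : A → ℕ) c → (∀ x → x ≢ c → f x ≡ 0) → ∑ f ≡ f c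
    ∑-single f c z = trans (∑-cong pt) (∑-δ c f)
      where
      pt : ∀ x → f x ≡ χ (x ≟ c) * f x
      pt x with x ≟ c
      ... | yes _ = sym (ℕ.+-identityʳ (f x))
      ... | no x≢c = z x x≢c

    ∑-bij : (σ τ : A → A) → (∀ x → τ (σ x) ≡ x) → (∀ y → σ (τ y) ≡ y) → ∀ (f : A → ℕ) → ∑ (f ∘ σ) ≡ ∑ f
    ∑-bij σ τ τσ στ f = begin
      ∑ (λ x → f (σ x))                        ≡⟨ ∑-cong (λ x → sym (∑-δ (σ x) f)) ⟩
      ∑ (λ x → ∑ (λ y → χ (y ≟ σ x) * f y))    ≡⟨ ∑-swap ∑ additive (λ x y → χ (y ≟ σ x) * f y) ⟩
      ∑ (λ y → ∑ (λ x → χ (y ≟ σ x) * f y))    ≡⟨ ∑-cong (λ y → ∑-cong (λ x → cong (_* f y) (same-delta x y))) ⟩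
      ∑ (λ y → ∑ (λ x → χ (x ≟ τ y) * f y))    ≡⟨ ∑-cong (λ y → ∑-δ (τ y) (λ _ → f y)) ⟩
      ∑ f                                       ∎
      where
      same-delta : ∀ x y → χ (y ≟ σ x) ≡ χ (x ≟ τ y)
      same-delta x y = χ-⇔ (y ≟ σ x) (x ≟ τ y)
        (λ e → trans (sym (τσ x)) (cong τ (sym e))) (λ e → trans (sym (στ y)) (cong σ (sym e)))

    count-≥1 : ∀ (P : A → Bool) c → P c ≡ true → 1 ≤ count P
    count-≥1 P c Pc = ℕ.≤-trans (ℕ.≤-reflexive (trans (cong 𝟙 (sym Pc)) (sym (∑-δ c (𝟙 ∘ P))))) (∑-mono pt)
      where
      pt : ∀ y → χ (y ≟ c) * 𝟙 (P y) ≤ 𝟙 (P y)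
      pt y with y ≟ c
      ... | yes _ = ℕ.≤-reflexive (ℕ.+-identityʳ _)
      ... | no _ = z≤n

    ∑-split : ∀ (f : A → ℕ) c u v → f c ≡ u → (∀ x → x ≢ c → f x ≡ v) → ∑ f + v ≡ u + ∑ (λ _ → v)
    ∑-split f c u v fc≡u f≡v = begin
      ∑ f + v                                  ≡⟨ cong (∑ f +_) (∑-δ c (λ _ → v)) ⟨
      ∑ f + ∑ (λ x → χ (x ≟ c) * v)            ≡⟨ ∑-+ _ _ ⟨
      ∑ (λ x → f x + χ (x ≟ c) * v)            ≡⟨ ∑-cong pointwise ⟩
      ∑ (λ x → χ (x ≟ c) * u + v)              ≡⟨ ∑-+ _ _ ⟩
      ∑ (λ x → χ (x ≟ c) * u) + ∑ (λ _ → v)    ≡⟨ cong (_+ ∑ (λ _ → v)) (∑-δ c (λ _ → u)) ⟩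
      u + ∑ (λ _ → v)                          ∎
      where
      pointwise : ∀ x → f x + χ (x ≟ c) * v ≡ χ (x ≟ c) * u + v
      pointwise x with x ≟ c
      ... | yes refl = trans (cong₂ _+_ fc≡u (ℕ.+-identityʳ v)) (cong (_+ v) (sym (ℕ.+-identityʳ u)))
      ... | no x≢c = trans (cong (_+ 0) (f≡v x x≢c)) (ℕ.+-identityʳ v)

    count≡1⇒unique : ∀ (P : A → Bool) c x → P c ≡ true → P x ≡ true → count P ≡ 1 → x ≡ c
    count≡1⇒unique P c x Pc Px |P|≡1 with x ≟ c
    ... | yes x≡c = x≡c
    ... | no x≢c = ⊥-elim (ℕ.<⇒≱ (ℕ.n<1+n 1) (ℕ.≤-trans (ℕ.≤-reflexive (sym two)) (ℕ.≤-trans (∑-mono pointwise) (ℕ.≤-reflexive |P|≡1))))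
      where
      two : ∑ (λ y → χ (y ≟ c) * 1 + χ (y ≟ x) * 1) ≡ 2
      two = trans (∑-+ _ _) (cong₂ _+_ (∑-δ c (λ _ → 1)) (∑-δ x (λ _ → 1)))
      pointwise : ∀ y → χ (y ≟ c) * 1 + χ (y ≟ x) * 1 ≤ 𝟙 (P y)
      pointwise y with y ≟ c | y ≟ x
      ... | yes refl | yes refl = ⊥-elim (x≢c refl)
      ... | yes refl | no _ = ℕ.≤-reflexive (cong 𝟙 (sym Pc))
      ... | no _ | yes refl = ℕ.≤-reflexive (cong 𝟙 (sym Px))
      ... | no _ | no _ = z≤n

    two-points : ∀ {P : A → Set} (P? : ∀ x → Dec (P x)) c → 2 ≤ ∑ (λ x → χ (P? x)) → Σ A λ x → P x × x ≢ c
    two-points {P} P? c 2≤ = pick (∑-pos elsewhere elsewhere-pos)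
      where
      elsewhere : A → ℕ
      elsewhere x with x ≟ c
      ... | yes _ = 0
      ... | no _ = χ (P? x)
      pointwise : ∀ x → χ (P? x) ≤ χ (x ≟ c) * 1 + elsewhere x
      pointwise x with x ≟ c
      ... | yes _ = χ-≤1 (P? x)
      ... | no _ = ℕ.≤-refl
      elsewhere-pos : 0 < ∑ elsewhere
      elsewhere-pos = ℕ.+-cancelˡ-< 1 0 (∑ elsewhere) (ℕ.<-≤-trans 2≤ (ℕ.≤-trans (∑-mono pointwise)
        (ℕ.≤-reflexive (trans (∑-+ _ _) (cong (_+ ∑ elsewhere) (∑-δ c (λ _ → 1)))))))
      holds : ∀ x → 0 < elsewhere x → P x
      holds x pos with x ≟ c
      holds x () | yes _
      ... | no _ with P? x
      ...   | yes Px = Px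
      holds x () | no _ | no _
      differs : ∀ x → 0 < elsewhere x → x ≢ c
      differs x pos with x ≟ c
      differs x () | yes _
      ... | no x≢c = x≢c
      pick : ∃ (λ x → 0 < elsewhere x) → Σ A λ x → P x × x ≢ c
      pick (x , pos) = x , holds x pos , differs x pos

  ∑Fin : ∀ n → (Fin n → ℕ) → ℕ
  ∑Fin zero f = 0
  ∑Fin (suc n) f = f Fin.zero + ∑Fin n (f ∘ Fin.suc)

  ∑Fin-cong : ∀ n {f g} → (∀ x → f x ≡ g x) → ∑Fin n f ≡ ∑Fin n g
  ∑Fin-cong zero e = refl
  ∑Fin-cong (suc n) e = cong₂ _+_ (e Fin.zero) (∑Fin-cong n (e ∘ Fin.suc))

  ∑Fin-+ : ∀ n f g → ∑Fin n (λ x → f x + g x) ≡ ∑Fin n f + ∑Fin n g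
  ∑Fin-+ zero f g = refl
  ∑Fin-+ (suc n) f g = trans (cong (f Fin.zero + g Fin.zero +_) (∑Fin-+ n _ _))
                             (+-interchange (f Fin.zero) (g Fin.zero) _ _)

  ∑Fin-0 : ∀ n → ∑Fin n (λ _ → 0) ≡ 0
  ∑Fin-0 zero = refl
  ∑Fin-0 (suc n) = ∑Fin-0 n

  ∑Fin-const : ∀ n k → ∑Fin n (λ _ → k) ≡ n * k
  ∑Fin-const zero k = refl
  ∑Fin-const (suc n) k = cong (k +_) (∑Fin-const n k)

  ∑Fin-swap : ∀ n {X : Set} (S : (X → ℕ) → ℕ) → Additive S → ∀ (f : Fin n → X → ℕ) →
              ∑Fin n (λ x → S (f x)) ≡ S (λ y → ∑Fin n (λ x → f x y))
  ∑Fin-swap zero S ad f = sym (Additive.S-0 ad)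
  ∑Fin-swap (suc n) S ad f = trans (cong (S (f Fin.zero) +_) (∑Fin-swap n S ad (f ∘ Fin.suc))) (sym (Additive.S-+ ad _ _))

  ∑Fin-δ : ∀ n c (g : Fin n → ℕ) → ∑Fin n (λ x → χ (x Fin.≟ c) * g x) ≡ g c
  ∑Fin-δ (suc n) Fin.zero g = begin
    1 * g Fin.zero + ∑Fin n (λ x → χ (Fin.suc x Fin.≟ Fin.zero) * g (Fin.suc x))
      ≡⟨ cong (1 * g Fin.zero +_) (trans (∑Fin-cong n (λ x → cong (_* g (Fin.suc x)) (χ-no (Fin.suc x Fin.≟ Fin.zero) (λ ())))) (∑Fin-0 n)) ⟩
    1 * g Fin.zero + 0 ≡⟨ trans (ℕ.+-identityʳ _) (ℕ.*-identityˡ _) ⟩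
    g Fin.zero ∎
  ∑Fin-δ (suc n) (Fin.suc c) g = begin
    0 + ∑Fin n (λ x → χ (Fin.suc x Fin.≟ Fin.suc c) * g (Fin.suc x))
      ≡⟨ ∑Fin-cong n (λ x → cong (_* g (Fin.suc x)) (χ-⇔ (Fin.suc x Fin.≟ Fin.suc c) (x Fin.≟ c) Fin.suc-injective (cong Fin.suc))) ⟩
    ∑Fin n (λ x → χ (x Fin.≟ c) * g (Fin.suc x)) ≡⟨ ∑Fin-δ n c (g ∘ Fin.suc) ⟩
    g (Fin.suc c) ∎

  ∑Fin-mono : ∀ n {f g} → (∀ x → f x ≤ g x) → ∑Fin n f ≤ ∑Fin n g
  ∑Fin-mono zero le = z≤n
  ∑Fin-mono (suc n) le = ℕ.+-mono-≤ (le Fin.zero) (∑Fin-mono n (le ∘ Fin.suc))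

  ∑Fin-pos : ∀ n f → 0 < ∑Fin n f → ∃ λ x → 0 < f x
  ∑Fin-pos (suc n) f pos with f Fin.zero in e
  ... | suc k = Fin.zero , subst (0 <_) (sym e) (s≤s z≤n)
  ... | zero with ∑Fin-pos n (f ∘ Fin.suc) pos
  ... | x , px = Fin.suc x , px

  enumFin : ∀ n → Enumerable (Fin n)
  enumFin n = record
    { ∑ = ∑Fin n
    ; additive = record { S-cong = ∑Fin-cong n ; S-+ = ∑Fin-+ n ; S-0 = ∑Fin-0 n }
    ; ∑-swap = ∑Fin-swap n
    ; _≟_ = Fin._≟_
    ; ∑-δ = ∑Fin-δ n
    ; ∑-mono = ∑Fin-mono n
    ; ∑-pos = ∑Fin-pos n }

  module Product {A B C : Set} (EA : Enumerable A) (EB : Enumerable B) (mk : A → B → C) (un : C → A × B)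
      (mk-un : ∀ z → mk (proj₁ (un z)) (proj₂ (un z)) ≡ z)
      (un-mk : ∀ a b → un (mk a b) ≡ (a , b)) where
    private
      module A = Enumerable EA
      module B = Enumerable EB

    ∑C : (C → ℕ) → ℕ
    ∑C f = A.∑ (λ a → B.∑ (λ b → f (mk a b)))

    additiveC : Additive ∑C
    additiveC = record
      { S-cong = λ e → A.∑-cong (λ a → B.∑-cong (λ b → e (mk a b)))
      ; S-+ = λ f g → trans (A.∑-cong (λ a → B.∑-+ _ _)) (A.∑-+ _ _)
      ; S-0 = trans (A.∑-cong (λ a → B.∑-0)) A.∑-0 }

    swapC : ∀ {X : Set} (S : (X → ℕ) → ℕ) → Additive S → ∀ (f : C → X → ℕ) →
            ∑C (λ x → S (f x)) ≡ S (λ y → ∑C (λ x → f x y))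
    swapC S ad f = trans (A.∑-cong (λ a → B.∑-swap S ad (λ b → f (mk a b))))
                         (A.∑-swap S ad (λ a y → B.∑ (λ b → f (mk a b) y)))

    fst : C → A
    fst = proj₁ ∘ un
    snd : C → B
    snd = proj₂ ∘ un

    _≟C_ : DecidableEquality C
    z ≟C w with fst z A.≟ fst w | snd z B.≟ snd w
    ... | yes e₁ | yes e₂ = yes (trans (sym (mk-un z)) (trans (cong₂ mk e₁ e₂) (mk-un w)))
    ... | no ne | _ = no (λ e → ne (cong fst e))
    ... | yes _ | no ne = no (λ e → ne (cong snd e))

    χ-mk : ∀ a b a' b' → χ (mk a b ≟C mk a' b') ≡ χ (a A.≟ a') * χ (b B.≟ b')
    χ-mk a b a' b' with a A.≟ a' | b B.≟ b'
    ... | yes refl | yes refl = χ-yes (mk a b ≟C mk a b) refl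
    ... | no ne | _ = χ-no (mk a b ≟C mk a' b') (λ e → ne (trans (sym (cong proj₁ (un-mk a b))) (trans (cong fst e) (cong proj₁ (un-mk a' b')))))
    ... | yes _ | no ne = χ-no (mk a b ≟C mk a' b') (λ e → ne (trans (sym (cong proj₂ (un-mk a b))) (trans (cong snd e) (cong proj₂ (un-mk a' b')))))

    δC : ∀ c (g : C → ℕ) → ∑C (λ x → χ (x ≟C c) * g x) ≡ g c
    δC c g = begin
      A.∑ (λ a → B.∑ (λ b → χ (mk a b ≟C c) * g (mk a b)))
        ≡⟨ A.∑-cong (λ a → B.∑-cong (λ b → cong (λ w → χ (mk a b ≟C w) * g (mk a b)) (sym (mk-un c)))) ⟩
      A.∑ (λ a → B.∑ (λ b → χ (mk a b ≟C mk c₁ c₂) * g (mk a b)))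
        ≡⟨ A.∑-cong (λ a → B.∑-cong (λ b → trans (cong (_* g (mk a b)) (χ-mk a b c₁ c₂)) (ℕ.*-assoc (χ (a A.≟ c₁)) _ _))) ⟩
      A.∑ (λ a → B.∑ (λ b → χ (a A.≟ c₁) * (χ (b B.≟ c₂) * g (mk a b))))
        ≡⟨ A.∑-cong (λ a → B.∑-*ˡ (χ (a A.≟ c₁)) _) ⟩
      A.∑ (λ a → χ (a A.≟ c₁) * B.∑ (λ b → χ (b B.≟ c₂) * g (mk a b)))
        ≡⟨ A.∑-cong (λ a → cong (χ (a A.≟ c₁) *_) (B.∑-δ c₂ (λ b → g (mk a b)))) ⟩
      A.∑ (λ a → χ (a A.≟ c₁) * g (mk a c₂))   ≡⟨ A.∑-δ c₁ (λ a → g (mk a c₂)) ⟩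
      g (mk c₁ c₂)                              ≡⟨ cong g (mk-un c) ⟩
      g c                                       ∎
      where
      c₁ : A
      c₁ = fst c
      c₂ : B
      c₂ = snd c

    enumerable : Enumerable C
    enumerable = record
      { ∑ = ∑C
      ; additive = additiveC
      ; ∑-swap = swapC
      ; _≟_ = _≟C_
      ; ∑-δ = δC
      ; ∑-mono = λ le → A.∑-mono (λ a → B.∑-mono (λ b → le (mk a b)))
      ; ∑-pos = λ f pos → let (a , pa) = A.∑-pos _ pos ; (b , pb) = B.∑-pos _ pa in mk a b , pb }

module MatrixSums where

  open import Defs
  open FiniteSums
  open import Data.Nat using (ℕ; zero; suc; _+_; NonZero)
  open import Data.Fin as Fin using (Fin)
  open import Data.Product using (_×_; _,_)
  open import Data.Bool using (Bool)
  open import Data.List using (List; []; _∷_; map; cartesianProductWith; allFin; tabulate)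
  open import Data.List.Properties using (map-++; map-∘; map-tabulate)
  open import Data.Nat.ListAction using (sum)
  open import Data.Nat.ListAction.Properties using (sum-++)
  open import Relation.Binary.PropositionalEquality
  open import Function using (_∘_)
  open ≡-Reasoning

  ∑List : ∀ {A : Set} → List A → (A → ℕ) → ℕ
  ∑List xs g = sum (map g xs)

  ∑List-cong : ∀ {A : Set} (xs : List A) {f g} → (∀ x → f x ≡ g x) → ∑List xs f ≡ ∑List xs g
  ∑List-cong [] e = refl
  ∑List-cong (x ∷ xs) e = cong₂ _+_ (e x) (∑List-cong xs e)

  ∑List-cartesianProductWith : ∀ {A B C : Set} (f : A → B → C) xs ys (φ : C → ℕ) →
    ∑List (cartesianProductWith f xs ys) φ ≡ ∑List xs (λ x → ∑List ys (λ y → φ (f x y)))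
  ∑List-cartesianProductWith f [] ys φ = refl
  ∑List-cartesianProductWith f (x ∷ xs) ys φ = begin
    sum (map φ (map (f x) ys Data.List.++ cartesianProductWith f xs ys))
      ≡⟨ cong sum (map-++ φ (map (f x) ys) _) ⟩
    sum (map φ (map (f x) ys) Data.List.++ map φ (cartesianProductWith f xs ys))
      ≡⟨ sum-++ (map φ (map (f x) ys)) _ ⟩
    sum (map φ (map (f x) ys)) + ∑List (cartesianProductWith f xs ys) φ
      ≡⟨ cong₂ _+_ (cong sum (sym (map-∘ ys))) (∑List-cartesianProductWith f xs ys φ) ⟩
    ∑List ys (φ ∘ f x) + ∑List xs (λ x → ∑List ys (λ y → φ (f x y))) ∎
    where import Data.List

  ∑List-allFin : ∀ n (g : Fin n → ℕ) → ∑List (allFin n) g ≡ ∑Fin n g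
  ∑List-allFin n g = trans (cong sum (map-tabulate (λ i → i) g)) (sum-tabulate n g)
    where
    sum-tabulate : ∀ n (g : Fin n → ℕ) → sum (tabulate g) ≡ ∑Fin n g
    sum-tabulate zero g = refl
    sum-tabulate (suc n) g = cong (g Fin.zero +_) (sum-tabulate n (g ∘ Fin.suc))

  module Enumerations (p : ℕ) .{{_ : NonZero p}} where

    enumF : Enumerable (Fin p)
    enumF = enumFin p

    enumF² : Enumerable (Fin p × Fin p)
    enumF² = Product.enumerable enumF enumF _,_ (λ z → z) (λ _ → refl) (λ _ _ → refl)

    enumMat : Enumerable (Mat p)
    enumMat = Product.enumerable enumF² enumF² (λ { (a , b) (c , d) → mat a b c d })
      (λ { (mat a b c d) → (a , b) , (c , d) }) (λ { (mat a b c d) → refl }) (λ _ _ → refl)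

    open Enumerable enumMat public using () renaming (∑ to ∑Mat; count to countMat)

    card≡count : ∀ (S : Mat p → Bool) → card p S ≡ countMat S
    card≡count S = begin
      ∑List (allMats p) h
        ≡⟨ ∑List-cartesianProductWith (λ f g → f g) L₃ A h ⟩
      ∑List L₃ (λ g → ∑List A (λ d → h (g d)))
        ≡⟨ ∑List-cartesianProductWith (λ f g → f g) L₂ A _ ⟩
      ∑List L₂ (λ g → ∑List A (λ c → ∑List A (λ d → h (g c d))))
        ≡⟨ ∑List-cartesianProductWith mat A A _ ⟩
      ∑List A (λ a → ∑List A (λ b → ∑List A (λ c → ∑List A (λ d → h (mat a b c d)))))
        ≡⟨ ∑List-cong A (λ a → ∑List-cong A (λ b → ∑List-cong A (λ c → ∑List-allFin p _))) ⟩
      ∑List A (λ a → ∑List A (λ b → ∑List A (λ c → ∑Fin p (λ d → h (mat a b c d)))))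
        ≡⟨ ∑List-cong A (λ a → ∑List-cong A (λ b → ∑List-allFin p _)) ⟩
      ∑List A (λ a → ∑List A (λ b → ∑Fin p (λ c → ∑Fin p (λ d → h (mat a b c d)))))
        ≡⟨ trans (∑List-cong A (λ a → ∑List-allFin p _)) (∑List-allFin p _) ⟩
      countMat S ∎
      where
      h : Mat p → ℕ
      h M = 𝟙 (S M)
      A : List (Fin p)
      A = allFin p
      L₂ : List (Fin p → Fin p → Mat p)
      L₂ = cartesianProductWith mat A A
      L₃ : List (Fin p → Mat p)
      L₃ = cartesianProductWith (λ f g → f g) L₂ A

module Powers where

  open import Defs
  open PrimeFields
  open import Data.Nat as ℕ using (ℕ; zero; suc; NonZero; _∸_)
  import Data.Nat.Properties as ℕ
  open import Data.Fin as Fin using (Fin)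
  import Data.Fin.Properties as Fin
  open import Data.Fin.Permutation using (Permutation; permutation)
  open import Data.Vec.Functional using (Vector; removeAt)
  open import Data.Nat.Primality using (Prime)
  open import Data.Product using (proj₁; proj₂)
  open import Data.Empty using (⊥-elim)
  open import Relation.Binary.PropositionalEquality
  open import Relation.Nullary using (yes; no)
  open import Algebra.Bundles using (CommutativeRing)
  open import Function using (_∘_)
  open ≡-Reasoning

  module Fermat (p : ℕ) .{{_ : NonZero p}} (p-prime : Prime p) where

    open PrimeField p p-prime
    open CommutativeRing commutativeRing using (*-commutativeMonoid)
    open import Algebra.Properties.CommutativeSemiring.Exp commutativeSemiring public
      using (^-homo-*; ^-assocʳ; ^-distrib-*) renaming (_^_ to _^'_)
    open import Algebra.Properties.CommutativeMonoid.Sum *-commutativeMonoid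
      using (sum-permute; sum-remove; ∑-distrib-+; sum-cong-≗) renaming (sum to ∏)

    1^n≡1 : ∀ n → 1' ^' n ≡ 1'
    1^n≡1 zero = refl
    1^n≡1 (suc n) = trans (*-identityˡ _) (1^n≡1 n)

    0^n≡0 : ∀ n → 0' ^' suc n ≡ 0'
    0^n≡0 n = zeroˡ _

    ∏-nonzero : ∀ {n} (t : Vector F n) → (∀ i → t i ≢ 0') → ∏ t ≢ 0'
    ∏-nonzero {zero} t t≢0 = 1≢0
    ∏-nonzero {suc n} t t≢0 = *-nonzero _ _ (t≢0 Fin.zero) (∏-nonzero (t ∘ Fin.suc) (t≢0 ∘ Fin.suc))

    ∏-const : ∀ n (t : Vector F n) x → (∀ i → t i ≡ x) → ∏ t ≡ x ^' n
    ∏-const zero t x e = refl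
    ∏-const (suc n) t x e = cong₂ _*'_ (e Fin.zero) (∏-const n (t ∘ Fin.suc) x (e ∘ Fin.suc))

    -- Multiplying all nonzero elements of Z/pZ by x permutes them; comparing the
    -- two products gives x ^ (p - 1) = 1.  Zero is kept as a neutral factor 1.
    fermat : ∀ x → x ≢ 0' → x ^' (p ∸ 1) ≡ 1'
    fermat x x≢0 = sym (*-cancelʳ 1' (x ^' (p ∸ 1)) (∏ unit) (∏-nonzero unit unit≢0) (begin
        1' *' ∏ unit                 ≡⟨ *-identityˡ (∏ unit) ⟩
        ∏ unit                       ≡⟨ sum-permute unit scaling ⟩
        ∏ (unit ∘ (x *'_))           ≡⟨ sum-cong-≗ unit-scaled ⟩
        ∏ (λ y → factor y *' unit y) ≡⟨ ∑-distrib-+ factor unit ⟩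
        ∏ factor *' ∏ unit           ≡⟨ cong (_*' ∏ unit) (∏-factor p refl) ⟩
        x ^' (p ∸ 1) *' ∏ unit       ∎))
      where
      unit : F → F
      unit y with y Fin.≟ 0'
      ... | yes _ = 1'
      ... | no _ = y

      unit≢0 : ∀ y → unit y ≢ 0'
      unit≢0 y with y Fin.≟ 0'
      ... | yes _ = 1≢0
      ... | no y≢0 = y≢0

      -- the factor by which scaling by x changes unit y
      factor : F → F
      factor y with y Fin.≟ 0'
      ... | yes _ = 1'
      ... | no _ = x

      x⁻¹ : F
      x⁻¹ = proj₁ (inverse x x≢0)
      x*x⁻¹ : x *' x⁻¹ ≡ 1'
      x*x⁻¹ = proj₂ (inverse x x≢0)

      scaling : Permutation p p
      scaling = permutation (x *'_) (x⁻¹ *'_)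
        (λ y → trans (sym (*-assoc x x⁻¹ y)) (trans (cong (_*' y) x*x⁻¹) (*-identityˡ y)))
        (λ y → trans (sym (*-assoc x⁻¹ x y)) (trans (cong (_*' y) (trans (*-comm x⁻¹ x) x*x⁻¹)) (*-identityˡ y)))

      unit-scaled : ∀ y → unit (x *' y) ≡ factor y *' unit y
      unit-scaled y with y Fin.≟ 0' | (x *' y) Fin.≟ 0'
      ... | yes _ | yes _ = sym (*-identityˡ 1')
      ... | yes y≡0 | no xy≢0 = ⊥-elim (xy≢0 (trans (cong (x *'_) y≡0) (zeroʳ x)))
      ... | no y≢0 | yes xy≡0 = ⊥-elim (*-nonzero x y x≢0 y≢0 xy≡0)
      ... | no _ | no _ = refl

      -- factor is 1 at 0 and x at the p - 1 other points
      ∏-factor : ∀ q → q ≡ p → ∏ factor ≡ x ^' (p ∸ 1)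
      ∏-factor zero q≡p = ⊥-elim (ℕ.≢-nonZero⁻¹ p (sym q≡p))
      ∏-factor (suc k) refl = begin
        ∏ factor                                ≡⟨ sum-remove {i = 0'} factor ⟩
        factor 0' *' ∏ (removeAt factor 0')     ≡⟨ cong₂ _*'_ factor-0 (∏-const k (removeAt factor 0') x factor-rest) ⟩
        1' *' x ^' k                            ≡⟨ *-identityˡ _ ⟩
        x ^' k                                  ∎
        where
        factor-0 : factor 0' ≡ 1'
        factor-0 with 0' Fin.≟ 0'
        ... | yes _ = refl
        ... | no 0≢0 = ⊥-elim (0≢0 refl)
        factor-rest : ∀ i → removeAt factor 0' i ≡ x
        factor-rest i with Fin.punchIn 0' i Fin.≟ 0'
        ... | yes e = ⊥-elim (Fin.punchInᵢ≢i 0' i e)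
        ... | no _ = refl

module Polynomials where

  open import Defs
  open FiniteSums
  open PrimeFields
  open Powers
  open import Data.Nat as ℕ using (ℕ; zero; suc; NonZero; _∸_; _≤_; _<_; z≤n; s≤s)
  import Data.Nat.Properties as ℕ
  open import Data.Fin as Fin using (Fin)
  import Data.Fin.Properties as Fin
  open import Data.List using (List; []; _∷_; _++_; length; replicate)
  open import Data.List.Properties using (length-++; length-replicate)
  open import Data.Nat.Primality using (Prime)
  open import Data.Nat.Divisibility using (_∣_; divides)
  open import Data.Product using (_,_)
  open import Data.Sum using (_⊎_; inj₁; inj₂)
  open import Data.Empty using (⊥-elim)
  open import Relation.Binary.PropositionalEquality
  open import Relation.Nullary using (Dec; yes; no)

  -- For a ∣ p - 1 there are exactly a elements x of Z/pZ with x ^ a = 1.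
  -- Upper bound: a polynomial of degree n has at most n roots.  Lower bound:
  -- x ^ (p-1) - 1 = (x ^ a - 1)(1 + x ^ a + … + x ^ (p-1-a)) vanishes at the
  -- p - 1 nonzero elements (Fermat), and the second factor has at most p - 1 - a
  -- roots.
  module RootsOfUnity (p : ℕ) .{{_ : NonZero p}} (p-prime : Prime p) where

    open PrimeField p p-prime
    open Fermat p p-prime
    open Enumerable (enumFin p) using (∑-mono; ∑-+; ∑-δ; ∑-pos; ∑-cong; ∑-zero)
    open import Algebra.Solver.Ring.NaturalCoefficients commutativeSemiring numeral-≟

    -- the monic polynomial c₀ + c₁ x + … + cₙ₋₁ xⁿ⁻¹ + xⁿ with coefficients [c₀ … cₙ₋₁]
    evalMonic : List F → F → F
    evalMonic [] x = 1'
    evalMonic (c ∷ cs) x = c +' x *' evalMonic cs x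

    evalPoly : List F → F → F
    evalPoly [] x = 0'
    evalPoly (c ∷ cs) x = c +' x *' evalPoly cs x

    -- synthetic division of a monic polynomial by x - r: the coefficients of the quotient
    deflate : List F → F → List F
    deflate [] r = []
    deflate (c ∷ []) r = []
    deflate (c ∷ cs@(_ ∷ _)) r = evalMonic cs r ∷ deflate cs r

    deflate-length : ∀ c cs r → length (deflate (c ∷ cs) r) ≡ length cs
    deflate-length c [] r = refl
    deflate-length c (c' ∷ cs) r = cong suc (deflate-length c' cs r)

    -- f(x) - f(r) = (x - r) q(x), written without subtraction
    deflate-spec : ∀ c cs x r →
      evalMonic (c ∷ cs) x +' r *' evalMonic (deflate (c ∷ cs) r) x ≡ evalMonic (c ∷ cs) r +' x *' evalMonic (deflate (c ∷ cs) r) x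
    deflate-spec c [] x r = solve 3 (λ c x r → c :+ x :* con 1 :+ r :* con 1 := c :+ r :* con 1 :+ x :* con 1) refl c x r
    deflate-spec c (c' ∷ cs) x r = begin
      c +' x *' Ex +' r *' (Er +' x *' Q)   ≡⟨ solve 6 (λ c x r Ex Er Q → c :+ x :* Ex :+ r :* (Er :+ x :* Q) := c :+ r :* Er :+ x :* (Ex :+ r :* Q)) refl c x r Ex Er Q ⟩
      c +' r *' Er +' x *' (Ex +' r *' Q)   ≡⟨ cong (λ w → c +' r *' Er +' x *' w) (deflate-spec c' cs x r) ⟩
      c +' r *' Er +' x *' (Er +' x *' Q)   ∎
      where
      open ≡-Reasoning
      Ex Er Q : F
      Ex = evalMonic (c' ∷ cs) x
      Er = evalMonic (c' ∷ cs) r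
      Q = evalMonic (deflate (c' ∷ cs) r) x

    rootCount : List F → ℕ
    rootCount cs = ∑Fin p (λ x → χ (evalMonic cs x Fin.≟ 0'))

    deflate-roots : ∀ c cs r x → evalMonic (c ∷ cs) r ≡ 0' → evalMonic (c ∷ cs) x ≡ 0' →
      r *' evalMonic (deflate (c ∷ cs) r) x ≡ x *' evalMonic (deflate (c ∷ cs) r) x
    deflate-roots c cs r x fr≡0 fx≡0 = begin
      r *' q                          ≡⟨ +-identityˡ _ ⟨
      0' +' r *' q                    ≡⟨ cong (λ w → w +' r *' q) fx≡0 ⟨
      evalMonic (c ∷ cs) x +' r *' q  ≡⟨ deflate-spec c cs x r ⟩
      evalMonic (c ∷ cs) r +' x *' q  ≡⟨ cong (λ w → w +' x *' q) fr≡0 ⟩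
      0' +' x *' q                    ≡⟨ +-identityˡ _ ⟩
      x *' q                          ∎
      where
      open ≡-Reasoning
      q : F
      q = evalMonic (deflate (c ∷ cs) r) x

    root-split : ∀ c cs r → evalMonic (c ∷ cs) r ≡ 0' → ∀ x →
      χ (evalMonic (c ∷ cs) x Fin.≟ 0') ≤ χ (x Fin.≟ r) ℕ.* 1 ℕ.+ χ (evalMonic (deflate (c ∷ cs) r) x Fin.≟ 0')
    root-split c cs r fr≡0 x with evalMonic (c ∷ cs) x Fin.≟ 0'
    ... | no _ = z≤n
    ... | yes fx≡0 with *-cancelʳ-⊎ r x _ (deflate-roots c cs r x fr≡0 fx≡0)
    ...   | inj₁ r≡x = ℕ.≤-trans (ℕ.≤-reflexive (trans (sym (χ-yes (x Fin.≟ r) (sym r≡x))) (sym (ℕ.*-identityʳ _)))) (ℕ.m≤m+n _ _)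
    ...   | inj₂ q≡0 = ℕ.≤-trans (ℕ.≤-reflexive (sym (χ-yes (evalMonic (deflate (c ∷ cs) r) x Fin.≟ 0') q≡0))) (ℕ.m≤n+m _ _)

    root-bound : ∀ cs → rootCount cs ≤ length cs
    root-bound cs = bound (length cs) cs refl
      where
      bound : ∀ n cs → length cs ≡ n → rootCount cs ≤ n
      bound zero [] _ = ℕ.≤-reflexive (∑-zero _ (λ x → χ-no (1' Fin.≟ 0') 1≢0))
      bound (suc n) (c ∷ cs) len≡ with rootCount (c ∷ cs) in count≡
      ... | zero = z≤n
      ... | suc k with ∑-pos (λ x → χ (evalMonic (c ∷ cs) x Fin.≟ 0')) (subst (0 <_) (sym count≡) (s≤s z≤n))
      ... | r , root-r = begin
          suc k                                    ≡⟨ count≡ ⟨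
          rootCount (c ∷ cs)                       ≤⟨ ∑-mono (root-split c cs r (is-root (evalMonic (c ∷ cs) r Fin.≟ 0') root-r)) ⟩
          ∑Fin p (λ x → χ (x Fin.≟ r) ℕ.* 1 ℕ.+ χ (evalMonic Q x Fin.≟ 0'))
                                                   ≡⟨ ∑-+ _ _ ⟩
          ∑Fin p (λ x → χ (x Fin.≟ r) ℕ.* 1) ℕ.+ rootCount Q
                                                   ≡⟨ cong (ℕ._+ rootCount Q) (∑-δ r (λ _ → 1)) ⟩
          suc (rootCount Q)                        ≤⟨ s≤s (bound n Q (trans (deflate-length c cs r) (ℕ.suc-injective len≡))) ⟩
          suc n                                    ∎
        where
        open ℕ.≤-Reasoning
        Q : List F
        Q = deflate (c ∷ cs) r
        is-root : ∀ {P : Set} (d : Dec P) → 0 < χ d → P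
        is-root (yes e) _ = e

    μ-count : ℕ → ℕ
    μ-count a = ∑Fin p (λ x → χ (x ^' a Fin.≟ 1'))

    evalMonic-xⁿ : ∀ n x → evalMonic (replicate n 0') x ≡ x ^' n
    evalMonic-xⁿ zero x = refl
    evalMonic-xⁿ (suc n) x = trans (+-identityˡ _) (cong (x *'_) (evalMonic-xⁿ n x))

    evalPoly-0 : ∀ n x → evalPoly (replicate n 0') x ≡ 0'
    evalPoly-0 zero x = refl
    evalPoly-0 (suc n) x = trans (+-identityˡ _) (trans (cong (x *'_) (evalPoly-0 n x)) (zeroʳ x))

    -- x is an a-th root of unity iff it is a root of -1 + xᵃ
    μ-upper : ∀ a' → μ-count (suc a') ≤ suc a'
    μ-upper a' = ℕ.≤-trans (ℕ.≤-reflexive (∑-cong same-roots))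
                   (ℕ.≤-trans (root-bound xᵃ-1) (ℕ.≤-reflexive (cong suc (length-replicate a'))))
      where
      xᵃ-1 : List F
      xᵃ-1 = -' 1' ∷ replicate a' 0'
      eval-xᵃ-1 : ∀ x → evalMonic xᵃ-1 x ≡ -' 1' +' x ^' suc a'
      eval-xᵃ-1 x = cong (λ w → -' 1' +' x *' w) (evalMonic-xⁿ a' x)
      same-roots : ∀ x → χ (x ^' suc a' Fin.≟ 1') ≡ χ (evalMonic xᵃ-1 x Fin.≟ 0')
      same-roots x = χ-⇔ (x ^' suc a' Fin.≟ 1') (evalMonic xᵃ-1 x Fin.≟ 0')
        (λ e → trans (eval-xᵃ-1 x) (trans (cong (-' 1' +'_) e) (-‿inverseˡ 1')))
        (λ e → trans (+-inverseʳ-unique (-' 1') _ (trans (sym (eval-xᵃ-1 x)) e)) (-‿involutive 1'))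

    -- coefficients of the monic polynomial 1 + y + y² + … + yᵏ in y = x ^ a
    geometric : (a' k : ℕ) → List F
    geometric a' zero = []
    geometric a' (suc k) = (1' ∷ replicate a' 0') ++ geometric a' k

    geometric-length : ∀ a' k → length (geometric a' k) ≡ k ℕ.* suc a'
    geometric-length a' zero = refl
    geometric-length a' (suc k) =
      trans (length-++ (1' ∷ replicate a' 0') {geometric a' k})
            (cong₂ ℕ._+_ (cong suc (length-replicate a')) (geometric-length a' k))

    evalMonic-++ : ∀ xs ys x → evalMonic (xs ++ ys) x ≡ evalPoly xs x +' x ^' length xs *' evalMonic ys x
    evalMonic-++ [] ys x = sym (trans (+-identityˡ _) (*-identityˡ _))
    evalMonic-++ (c ∷ xs) ys x = trans (cong (λ w → c +' x *' w) (evalMonic-++ xs ys x))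
      (solve 5 (λ c x L P E → c :+ x :* (L :+ P :* E) := c :+ x :* L :+ x :* P :* E) refl c x (evalPoly xs x) (x ^' length xs) (evalMonic ys x))

    geometric-step : ∀ a' k x → evalMonic (geometric a' (suc k)) x ≡ 1' +' x ^' suc a' *' evalMonic (geometric a' k) x
    geometric-step a' k x = trans (evalMonic-++ (1' ∷ replicate a' 0') (geometric a' k) x)
      (cong₂ (λ u n → u +' x ^' n *' evalMonic (geometric a' k) x)
        (trans (cong (λ w → 1' +' x *' w) (evalPoly-0 a' x)) (trans (cong (1' +'_) (zeroʳ x)) (+-identityʳ 1')))
        (cong suc (length-replicate a')))

    geometric-sum : ∀ a' k x →
      x ^' suc a' *' evalMonic (geometric a' k) x +' 1' ≡ evalMonic (geometric a' k) x +' x ^' (suc a' ℕ.* suc k)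
    geometric-sum a' zero x =
      trans (cong (_+' 1') (*-identityʳ (x ^' suc a')))
            (trans (+-comm (x ^' suc a') 1') (cong (λ n → 1' +' x ^' n) (sym (ℕ.*-identityʳ (suc a')))))
    geometric-sum a' (suc k) x = begin
      y *' G' +' 1'         ≡⟨ cong (λ w → y *' w +' 1') (geometric-step a' k x) ⟩
      y *' (1' +' y *' G) +' 1'
                            ≡⟨ solve 3 (λ y G o → y :* (o :+ y :* G) :+ o := y :* (y :* G :+ o) :+ o) refl y G 1' ⟩
      y *' (y *' G +' 1') +' 1'
                            ≡⟨ cong (λ w → y *' w +' 1') (geometric-sum a' k x) ⟩
      y *' (G +' s) +' 1'   ≡⟨ solve 4 (λ y G s o → y :* (G :+ s) :+ o := (o :+ y :* G) :+ y :* s) refl y G s 1' ⟩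
      (1' +' y *' G) +' y *' s
                            ≡⟨ cong₂ _+'_ (sym (geometric-step a' k x)) (sym (trans (cong (x ^'_) (ℕ.*-suc (suc a') (suc k))) (^-homo-* x (suc a') _))) ⟩
      G' +' x ^' (suc a' ℕ.* suc (suc k)) ∎
      where
      open ≡-Reasoning
      y G G' s : F
      y = x ^' suc a'
      G = evalMonic (geometric a' k) x
      G' = evalMonic (geometric a' (suc k)) x
      s = x ^' (suc a' ℕ.* suc k)

    nonzero-root : ∀ a' m' → p ∸ 1 ≡ suc m' ℕ.* suc a' → ∀ x → x ≢ 0' →
      x ^' suc a' ≡ 1' ⊎ evalMonic (geometric a' m') x ≡ 0'
    nonzero-root a' m' p-1≡ x x≢0 = *-cancelʳ-⊎ (x ^' suc a') 1' G (begin
      x ^' suc a' *' G         ≡⟨ +-cancelʳ 1' (x ^' suc a' *' G) G (trans (geometric-sum a' m' x) (cong (G +'_) xᵖ⁻¹≡1)) ⟩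
      G                        ≡⟨ *-identityˡ G ⟨
      1' *' G                  ∎)
      where
      open ≡-Reasoning
      G : F
      G = evalMonic (geometric a' m') x
      xᵖ⁻¹≡1 : x ^' (suc a' ℕ.* suc m') ≡ 1'
      xᵖ⁻¹≡1 = trans (cong (x ^'_) (trans (ℕ.*-comm (suc a') (suc m')) (sym p-1≡))) (fermat x x≢0)

    μ-lower : ∀ a' m' → p ∸ 1 ≡ suc m' ℕ.* suc a' → suc a' ≤ μ-count (suc a')
    μ-lower a' m' p-1≡ = ℕ.+-cancelˡ-≤ (suc (m' ℕ.* suc a')) _ _ (begin
        suc (m' ℕ.* suc a') ℕ.+ suc a'   ≡⟨ cong suc (ℕ.+-comm (m' ℕ.* suc a') (suc a')) ⟩
        suc (suc m' ℕ.* suc a')          ≡⟨ cong suc p-1≡ ⟨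
        suc (p ∸ 1)                      ≡⟨ ℕ.suc-pred p ⟩
        p                                ≡⟨ trans (∑Fin-const p 1) (ℕ.*-identityʳ p) ⟨
        ∑Fin p (λ _ → 1)                 ≤⟨ ∑-mono covered ⟩
        ∑Fin p (λ x → Z x ℕ.+ (U x ℕ.+ R x)) ≡⟨ ∑-+ Z (λ x → U x ℕ.+ R x) ⟩
        ∑Fin p Z ℕ.+ ∑Fin p (λ x → U x ℕ.+ R x) ≡⟨ cong₂ ℕ._+_ (∑-δ 0' (λ _ → 1)) (∑-+ U R) ⟩
        suc (μ-count (suc a') ℕ.+ rootCount G)
                                         ≤⟨ s≤s (ℕ.+-monoʳ-≤ (μ-count (suc a')) (ℕ.≤-trans (root-bound G) (ℕ.≤-reflexive (geometric-length a' m')))) ⟩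
        suc (μ-count (suc a') ℕ.+ m' ℕ.* suc a')
                                         ≡⟨ cong suc (ℕ.+-comm (μ-count (suc a')) _) ⟩
        suc (m' ℕ.* suc a') ℕ.+ μ-count (suc a') ∎)
      where
      open ℕ.≤-Reasoning
      G : List F
      G = geometric a' m'
      -- every x is 0, an a-th root of unity, or a root of G
      Z U R : F → ℕ
      Z x = χ (x Fin.≟ 0') ℕ.* 1
      U x = χ (x ^' suc a' Fin.≟ 1')
      R x = χ (evalMonic G x Fin.≟ 0')
      covered : ∀ x → 1 ≤ Z x ℕ.+ (U x ℕ.+ R x)
      covered x = χ-cover (x Fin.≟ 0') (x ^' suc a' Fin.≟ 1') (evalMonic G x Fin.≟ 0') (nonzero-root a' m' p-1≡ x)

    μ-count-divisor : ∀ a → a ∣ p ∸ 1 → μ-count a ≡ a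
    μ-count-divisor zero (divides m e) = ⊥-elim (ℕ.<⇒≢ (ℕ.m<n⇒0<n∸m 1<p) (sym (trans e (ℕ.*-zeroʳ m))))
    μ-count-divisor (suc a') (divides zero e) = ⊥-elim (ℕ.<⇒≢ (ℕ.m<n⇒0<n∸m 1<p) (sym e))
    μ-count-divisor (suc a') (divides (suc m') e) = ℕ.≤-antisym (μ-upper a') (μ-lower a' m' e)

module GeneralLinear where

  open import Defs
  open FiniteSums
  open MatrixSums
  open PrimeFields
  open import Data.Nat as ℕ using (ℕ; zero; suc; NonZero; _∸_; _+_; _*_; _^_; _<_)
  import Data.Nat.Properties as ℕ
  open import Data.Fin as Fin using (Fin; toℕ)
  import Data.Fin.Properties as Fin
  open import Data.Nat.Primality using (Prime)
  open import Data.Product using (proj₁; proj₂)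
  open import Data.Sum using (inj₁; inj₂)
  open import Data.Empty using (⊥-elim)
  open import Data.Bool using (true)
  open import Relation.Binary.PropositionalEquality
  open import Data.Nat.Tactic.RingSolver using (solve-∀)
  open ≡-Reasoning

  -- the arithmetic behind |GL₂(Z/pZ)|: if T = 2p - 1 then p⁴ - (p T + p³ - p²) = p (p+1) (p-1)²
  gl-order-arithmetic : ∀ p T → 0 < p → T + 1 ≡ p + p * 1 →
    p * (p * (p * p)) + p * p ≡ p * (p + 1) * (p ∸ 1) ^ 2 + (p * T + p * (p * p))
  gl-order-arithmetic (suc k) T _ T+1≡ = begin
    p * (p * (p * p)) + p * p                            ≡⟨ identity k ⟩
    p * (p + 1) * k ^ 2 + (p * (2 * k + 1) + p * (p * p)) ≡⟨ cong (λ t → p * (p + 1) * k ^ 2 + (p * t + p * (p * p))) T≡ ⟨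
    p * (p + 1) * k ^ 2 + (p * T + p * (p * p))           ∎
    where
    p : ℕ
    p = suc k
    T≡ : T ≡ 2 * k + 1
    T≡ = ℕ.+-cancelʳ-≡ 1 T (2 * k + 1) (trans T+1≡ (two-p k))
      where
      two-p : ∀ k → suc k + suc k * 1 ≡ 2 * k + 1 + 1
      two-p = solve-∀
    identity : ∀ k → suc k * (suc k * (suc k * suc k)) + suc k * suc k ≡
                     suc k * (suc k + 1) * (k * (k * 1)) + (suc k * (2 * k + 1) + suc k * (suc k * suc k))
    identity = solve-∀

  -- |GL₂(Z/pZ)| = p (p + 1) (p - 1)², by counting the singular matrices:
  -- ad = bc has p (2p - 1) solutions with a = 0 and p² with a ≠ 0.
  module GL2Order (p : ℕ) .{{_ : NonZero p}} (p-prime : Prime p) where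

    open PrimeField p p-prime
    open Enumerations p
    open Enumerable enumF using (∑-cong; ∑-δ; ∑-*ˡ; ∑-split)

    det≡0⇔ : ∀ a b c d → χ (det p (mat a b c d) Fin.≟ 0') ≡ χ (a *' d Fin.≟ b *' c)
    det≡0⇔ a b c d = χ-⇔ _ _ (x-y≡0⇒x≡y (a *' d) (b *' c)) x≡y⇒x-y≡0

    private
      toℕ≡0⇒≡0 : ∀ {x} → toℕ x ≡ 0 → x ≡ 0'
      toℕ≡0⇒≡0 e = Fin.toℕ-injective (trans e (sym toℕ-0))

    isGL-complement : ∀ M → 𝟙 (isGL p M) + χ (det p M Fin.≟ 0') ≡ 1
    isGL-complement M with toℕ (det p M) in e
    ... | zero = χ-yes (det p M Fin.≟ 0') (toℕ≡0⇒≡0 e)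
    ... | suc _ = cong suc (χ-no (det p M Fin.≟ 0') λ d≡0 → ℕ.1+n≢0 (trans (sym e) (trans (cong toℕ d≡0) toℕ-0)))

    det≢0⇒isGL : ∀ M → det p M ≢ 0' → isGL p M ≡ true
    det≢0⇒isGL M d≢0 with toℕ (det p M) in e
    ... | zero = ⊥-elim (d≢0 (toℕ≡0⇒≡0 e))
    ... | suc _ = refl

    isGL-I : isGL p (I p) ≡ true
    isGL-I = det≢0⇒isGL (I p) λ det≡0 →
      1≢0 (trans (sym (*-identityˡ 1')) (trans (x-y≡0⇒x≡y (1' *' 1') (0' *' 0') det≡0) (zeroˡ 0')))

    ∑-split-at-0 : ∀ (f : F → ℕ) u v → f 0' ≡ u → (∀ a → a ≢ 0' → f a ≡ v) → ∑Fin p f + v ≡ u + p * v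
    ∑-split-at-0 f u v f0≡u f≡v = trans (∑-split f 0' u v f0≡u f≡v) (cong (u +_) (∑Fin-const p v))

    unique-solution : ∀ a e → a ≢ 0' → ∑Fin p (λ d → χ (a *' d Fin.≟ e)) ≡ 1
    unique-solution a e a≢0 = trans (∑-cong pointwise) (∑-δ (a⁻¹ *' e) (λ _ → 1))
      where
      a⁻¹ : F
      a⁻¹ = proj₁ (inverse a a≢0)
      a*a⁻¹ : a *' a⁻¹ ≡ 1'
      a*a⁻¹ = proj₂ (inverse a a≢0)
      pointwise : ∀ d → χ (a *' d Fin.≟ e) ≡ χ (d Fin.≟ a⁻¹ *' e) * 1
      pointwise d = trans (χ-⇔ (a *' d Fin.≟ e) (d Fin.≟ a⁻¹ *' e)
        (λ ad≡e → trans (sym (*-identityˡ d)) (trans (cong (_*' d) (sym (trans (*-comm a⁻¹ a) a*a⁻¹))) (trans (*-assoc a⁻¹ a d) (cong (a⁻¹ *'_) ad≡e))))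
        (λ d≡ → trans (cong (a *'_) d≡) (trans (sym (*-assoc a a⁻¹ e)) (trans (cong (_*' e) a*a⁻¹) (*-identityˡ e)))))
        (sym (ℕ.*-identityʳ _))

    zero-products : ℕ
    zero-products = ∑Fin p (λ b → ∑Fin p (λ c → χ (0' Fin.≟ b *' c)))

    zero-products-count : zero-products + 1 ≡ p + p * 1
    zero-products-count = ∑-split-at-0 _ p 1 b≡0 b≢0
      where
      b≡0 : ∑Fin p (λ c → χ (0' Fin.≟ 0' *' c)) ≡ p
      b≡0 = trans (∑-cong (λ c → χ-yes (0' Fin.≟ 0' *' c) (sym (zeroˡ c)))) (trans (∑Fin-const p 1) (ℕ.*-identityʳ p))
      b≢0 : ∀ b → b ≢ 0' → ∑Fin p (λ c → χ (0' Fin.≟ b *' c)) ≡ 1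
      b≢0 b b≢0 = trans (∑-cong (λ c → trans (χ-⇔ _ (c Fin.≟ 0') (c≡0 c) (0≡bc c)) (sym (ℕ.*-identityʳ _)))) (∑-δ 0' (λ _ → 1))
        where
        0≡bc : ∀ c → c ≡ 0' → 0' ≡ b *' c
        0≡bc c c≡0 = sym (trans (cong (b *'_) c≡0) (zeroʳ b))
        c≡0 : ∀ c → 0' ≡ b *' c → c ≡ 0'
        c≡0 c e with no-zero-divisors b c (sym e)
        ... | inj₁ b≡0 = ⊥-elim (b≢0 b≡0)
        ... | inj₂ c≡0 = c≡0

    singular : ℕ
    singular = ∑Mat (λ M → χ (det p M Fin.≟ 0'))

    singular-count : singular + p * p ≡ p * zero-products + p * (p * p)
    singular-count = trans (cong (_+ p * p) (∑-cong (λ a → ∑-cong (λ b → ∑-cong (λ c → ∑-cong (λ d → det≡0⇔ a b c d))))))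
                           (∑-split-at-0 _ (p * zero-products) (p * p) a≡0 a≢0)
      where
      a≡0 : ∑Fin p (λ b → ∑Fin p (λ c → ∑Fin p (λ d → χ (0' *' d Fin.≟ b *' c)))) ≡ p * zero-products
      a≡0 = trans (∑-cong (λ b → ∑-cong (λ c → trans (∑-cong (λ d → χ-⇔ _ (0' Fin.≟ b *' c) (trans (sym (zeroˡ d))) (trans (zeroˡ d)))) (∑Fin-const p _))))
                  (trans (∑-cong (λ b → ∑-*ˡ p _)) (∑-*ˡ p _))
      a≢0 : ∀ a → a ≢ 0' → ∑Fin p (λ b → ∑Fin p (λ c → ∑Fin p (λ d → χ (a *' d Fin.≟ b *' c)))) ≡ p * p
      a≢0 a a≢0 = trans (∑-cong (λ b → trans (∑-cong (λ c → unique-solution a (b *' c) a≢0)) (trans (∑Fin-const p 1) (ℕ.*-identityʳ p)))) (∑Fin-const p p)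

    all-matrices : card p (isGL p) + singular ≡ p * (p * (p * p))
    all-matrices = begin
      card p (isGL p) + singular                                   ≡⟨ cong (_+ singular) (card≡count (isGL p)) ⟩
      ∑Mat (λ M → 𝟙 (isGL p M)) + singular                         ≡⟨ Enumerable.∑-+ enumMat _ _ ⟨
      ∑Mat (λ M → 𝟙 (isGL p M) + χ (det p M Fin.≟ 0'))             ≡⟨ Enumerable.∑-cong enumMat isGL-complement ⟩
      ∑Mat (λ M → 1)                                                ≡⟨ const-sum ⟩
      p * (p * (p * p))                                             ∎
      where
      const-sum : ∑Mat (λ M → 1) ≡ p * (p * (p * p))
      const-sum = begin
        ∑Fin p (λ a → ∑Fin p (λ b → ∑Fin p (λ c → ∑Fin p (λ d → 1))))
          ≡⟨ ∑-cong (λ a → ∑-cong (λ b → ∑-cong (λ c → trans (∑Fin-const p 1) (ℕ.*-identityʳ p)))) ⟩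
        ∑Fin p (λ a → ∑Fin p (λ b → ∑Fin p (λ c → p)))
          ≡⟨ ∑-cong (λ a → trans (∑-cong (λ b → ∑Fin-const p p)) (∑Fin-const p _)) ⟩
        ∑Fin p (λ a → p * (p * p))  ≡⟨ ∑Fin-const p _ ⟩
        p * (p * (p * p))            ∎

    card-GL : card p (isGL p) ≡ p * (p + 1) * (p ∸ 1) ^ 2
    card-GL = ℕ.+-cancelʳ-≡ (singular + p * p) _ _ (begin
      card p (isGL p) + (singular + p * p)   ≡⟨ ℕ.+-assoc (card p (isGL p)) singular (p * p) ⟨
      card p (isGL p) + singular + p * p     ≡⟨ cong (_+ p * p) all-matrices ⟩
      p * (p * (p * p)) + p * p              ≡⟨ gl-order-arithmetic p zero-products (ℕ.>-nonZero⁻¹ p) zero-products-count ⟩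
      p * (p + 1) * (p ∸ 1) ^ 2 + (p * zero-products + p * (p * p))
                                             ≡⟨ cong (p * (p + 1) * (p ∸ 1) ^ 2 +_) singular-count ⟨
      p * (p + 1) * (p ∸ 1) ^ 2 + (singular + p * p) ∎)

module Matrices where

  open import Defs
  open ModularArithmetic
  open import Data.Nat using (ℕ; NonZero)
  open import Data.Product using (_,_)
  open import Relation.Binary.PropositionalEquality
  open ≡-Reasoning

  module MatrixAlgebra (p : ℕ) .{{_ : NonZero p}} where

    open ZMod p
    open import Algebra.Solver.Ring.NaturalCoefficients commutativeSemiring numeral-≟

    infixl 7 _∙_
    _∙_ : Mat p → Mat p → Mat p
    _∙_ = _·_ p

    I₂ : Mat p
    I₂ = I p

    diag : F → F → Mat p
    diag a d = mat a 0' 0' d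

    mat≡ : ∀ {a b c d a' b' c' d' : F} → a ≡ a' → b ≡ b' → c ≡ c' → d ≡ d' → mat a b c d ≡ mat a' b' c' d'
    mat≡ refl refl refl refl = refl

    ∙-assoc : ∀ M N K → (M ∙ N) ∙ K ≡ M ∙ (N ∙ K)
    ∙-assoc (mat a b c d) (mat a' b' c' d') (mat a'' b'' c'' d'') =
      mat≡ (entry a b a' b' c' d' a'' c'') (entry a b a' b' c' d' b'' d'') (entry c d a' b' c' d' a'' c'') (entry c d a' b' c' d' b'' d'')
      where
      entry : ∀ a b a' b' c' d' a'' c'' →
        (a *' a' +' b *' c') *' a'' +' (a *' b' +' b *' d') *' c'' ≡ a *' (a' *' a'' +' b' *' c'') +' b *' (c' *' a'' +' d' *' c'')
      entry = solve 8 (λ a b a' b' c' d' a'' c'' →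
        (a :* a' :+ b :* c') :* a'' :+ (a :* b' :+ b :* d') :* c'' := a :* (a' :* a'' :+ b' :* c'') :+ b :* (c' :* a'' :+ d' :* c'')) refl

    ∙-identityˡ : ∀ M → I₂ ∙ M ≡ M
    ∙-identityˡ (mat a b c d) = mat≡ (first a c) (first b d) (second a c) (second b d)
      where
      first : ∀ a c → 1' *' a +' 0' *' c ≡ a
      first = solve 2 (λ a c → con 1 :* a :+ con 0 :* c := a) refl
      second : ∀ a c → 0' *' a +' 1' *' c ≡ c
      second = solve 2 (λ a c → con 0 :* a :+ con 1 :* c := c) refl

    ∙-identityʳ : ∀ M → M ∙ I₂ ≡ M
    ∙-identityʳ (mat a b c d) = mat≡ (first a b) (second a b) (first c d) (second c d)
      where
      first : ∀ a b → a *' 1' +' b *' 0' ≡ a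
      first = solve 2 (λ a b → a :* con 1 :+ b :* con 0 := a) refl
      second : ∀ a b → a *' 0' +' b *' 1' ≡ b
      second = solve 2 (λ a b → a :* con 0 :+ b :* con 1 := b) refl

    diag-∙ : ∀ a d a' d' → diag a d ∙ diag a' d' ≡ diag (a *' a') (d *' d')
    diag-∙ a d a' d' = mat≡
      (solve 2 (λ a a' → a :* a' :+ con 0 :* con 0 := a :* a') refl a a')
      (solve 2 (λ a d' → a :* con 0 :+ con 0 :* d' := con 0) refl a d')
      (solve 2 (λ d a' → con 0 :* a' :+ d :* con 0 := con 0) refl d a')
      (solve 2 (λ d d' → con 0 :* con 0 :+ d :* d' := d :* d') refl d d')

    scalar-central : ∀ M s → M ∙ diag s s ≡ diag s s ∙ M
    scalar-central (mat a b c d) s = mat≡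
      (solve 4 (λ a b c s → a :* s :+ b :* con 0 := s :* a :+ con 0 :* c) refl a b c s)
      (solve 4 (λ a b d s → a :* con 0 :+ b :* s := s :* b :+ con 0 :* d) refl a b d s)
      (solve 4 (λ a c d s → c :* s :+ d :* con 0 := con 0 :* a :+ s :* c) refl a c d s)
      (solve 4 (λ b c d s → c :* con 0 :+ d :* s := con 0 :* b :+ s :* d) refl b c d s)

    conj-cancel : ∀ P Q M → P ∙ Q ≡ I₂ → P ∙ (Q ∙ M ∙ P) ∙ Q ≡ M
    conj-cancel P Q M PQ≡I = begin
      P ∙ (Q ∙ M ∙ P) ∙ Q        ≡⟨ ∙-assoc P _ Q ⟩
      P ∙ ((Q ∙ M ∙ P) ∙ Q)      ≡⟨ cong (P ∙_) (∙-assoc (Q ∙ M) P Q) ⟩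
      P ∙ ((Q ∙ M) ∙ (P ∙ Q))    ≡⟨ cong (λ w → P ∙ ((Q ∙ M) ∙ w)) PQ≡I ⟩
      P ∙ ((Q ∙ M) ∙ I₂)         ≡⟨ cong (P ∙_) (∙-identityʳ _) ⟩
      P ∙ (Q ∙ M)                ≡⟨ ∙-assoc P Q M ⟨
      (P ∙ Q) ∙ M                ≡⟨ cong (_∙ M) PQ≡I ⟩
      I₂ ∙ M                     ≡⟨ ∙-identityˡ M ⟩
      M                          ∎

    conj-∙ : ∀ P Q M N → Q ∙ P ≡ I₂ → (P ∙ M ∙ Q) ∙ (P ∙ N ∙ Q) ≡ P ∙ (M ∙ N) ∙ Q
    conj-∙ P Q M N QP≡I = begin
      (P ∙ M ∙ Q) ∙ (P ∙ N ∙ Q)       ≡⟨ ∙-assoc (P ∙ M) Q _ ⟩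
      (P ∙ M) ∙ (Q ∙ (P ∙ N ∙ Q))     ≡⟨ cong ((P ∙ M) ∙_) (∙-assoc Q (P ∙ N) Q) ⟨
      (P ∙ M) ∙ (Q ∙ (P ∙ N) ∙ Q)     ≡⟨ cong (λ w → (P ∙ M) ∙ (w ∙ Q)) (∙-assoc Q P N) ⟨
      (P ∙ M) ∙ ((Q ∙ P) ∙ N ∙ Q)     ≡⟨ cong (λ w → (P ∙ M) ∙ (w ∙ N ∙ Q)) QP≡I ⟩
      (P ∙ M) ∙ (I₂ ∙ N ∙ Q)          ≡⟨ cong (λ w → (P ∙ M) ∙ (w ∙ Q)) (∙-identityˡ N) ⟩
      (P ∙ M) ∙ (N ∙ Q)               ≡⟨ ∙-assoc (P ∙ M) N Q ⟨
      P ∙ M ∙ N ∙ Q                   ≡⟨ cong (_∙ Q) (∙-assoc P M N) ⟩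
      P ∙ (M ∙ N) ∙ Q                 ∎

    -- a matrix whose conjugate is scalar is itself scalar (scalars are central)
    conj-scalar : ∀ P Q M → P ∙ Q ≡ I₂ → IsScalar p (Q ∙ M ∙ P) → Mat.a M ≡ Mat.d M
    conj-scalar P Q M PQ≡I (b≡0 , c≡0 , a≡d) = trans (cong Mat.a M≡) (cong Mat.d (sym M≡))
      where
      s : F
      s = Mat.a (Q ∙ M ∙ P)
      M≡ : M ≡ diag s s
      M≡ = begin
        M                      ≡⟨ conj-cancel P Q M PQ≡I ⟨
        P ∙ (Q ∙ M ∙ P) ∙ Q    ≡⟨ cong (λ w → P ∙ w ∙ Q) (mat≡ refl b≡0 c≡0 (sym a≡d)) ⟩
        P ∙ diag s s ∙ Q       ≡⟨ cong (_∙ Q) (scalar-central P s) ⟩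
        diag s s ∙ P ∙ Q       ≡⟨ ∙-assoc (diag s s) P Q ⟩
        diag s s ∙ (P ∙ Q)     ≡⟨ cong (diag s s ∙_) PQ≡I ⟩
        diag s s ∙ I₂          ≡⟨ ∙-identityʳ (diag s s) ⟩
        diag s s               ∎

module Cosets where

  open FiniteSums
  open import Data.Nat as ℕ using (ℕ; zero; suc; _+_; _≤_; _<_; s≤s; z≤n)
  import Data.Nat.Properties as ℕ
  open import Data.Nat.Divisibility using (_∣_; _∣0; ∣m∣n⇒∣m+n; ∣-refl)
  open import Data.Product using (Σ; _×_; _,_; proj₁; proj₂)
  open import Data.Bool using (Bool; true; false; _∧_; not)
  open import Relation.Binary.PropositionalEquality

  -- Lagrange's theorem in a finite commutative monoid: the order of a subgroup H
  -- divides the size of every H-stable set R of invertible elements, because R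
  -- is a disjoint union of cosets x H, each of size |H|.
  module Lagrange {A : Set} (E : Enumerable A) (_⊗_ : A → A → A) (ε : A)
      (⊗-assoc : ∀ x y z → (x ⊗ y) ⊗ z ≡ x ⊗ (y ⊗ z))
      (⊗-comm : ∀ x y → x ⊗ y ≡ y ⊗ x)
      (⊗-identityˡ : ∀ x → ε ⊗ x ≡ x) where

    open Enumerable E

    record IsSubgroup (H : A → Bool) : Set where
      field
        ε∈ : H ε ≡ true
        ⊗-closed : ∀ x y → H x ≡ true → H y ≡ true → H (x ⊗ y) ≡ true
        inverse-closed : ∀ x → H x ≡ true → Σ A λ y → (H y ≡ true) × (x ⊗ y ≡ ε)

    record IsUnion (H R : A → Bool) : Set where
      field
        invertible : ∀ x → R x ≡ true → Σ A λ y → x ⊗ y ≡ ε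
        stable : ∀ x h → R x ≡ true → H h ≡ true → R (x ⊗ h) ≡ true

    module _ (H : A → Bool) (H-subgroup : IsSubgroup H) where
      open IsSubgroup H-subgroup

      |H|≥1 : 1 ≤ count H
      |H|≥1 = count-≥1 H ε ε∈

      -- removing the coset x H from R leaves an H-stable set R' with |R| = |R'| + |H|
      module RemoveCoset (R : A → Bool) (R-union : IsUnion H R) (x : A) (x∈R : R x ≡ true) where
        open IsUnion R-union

        x⁻¹ : A
        x⁻¹ = proj₁ (invertible x x∈R)
        x⊗x⁻¹ : x ⊗ x⁻¹ ≡ ε
        x⊗x⁻¹ = proj₂ (invertible x x∈R)

        R' : A → Bool
        R' y = R y ∧ not (H (x⁻¹ ⊗ y))

        x⊗[x⁻¹⊗y] : ∀ y → x ⊗ (x⁻¹ ⊗ y) ≡ y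
        x⊗[x⁻¹⊗y] y = trans (sym (⊗-assoc x x⁻¹ y)) (trans (cong (_⊗ y) x⊗x⁻¹) (⊗-identityˡ y))

        x⁻¹⊗[x⊗y] : ∀ y → x⁻¹ ⊗ (x ⊗ y) ≡ y
        x⁻¹⊗[x⊗y] y = trans (sym (⊗-assoc x⁻¹ x y)) (trans (cong (_⊗ y) (trans (⊗-comm x⁻¹ x) x⊗x⁻¹)) (⊗-identityˡ y))

        -- every y with x⁻¹ y ∈ H lies in R
        pointwise : ∀ y → 𝟙 (R y) ≡ 𝟙 (R' y) + 𝟙 (H (x⁻¹ ⊗ y))
        pointwise y with H (x⁻¹ ⊗ y) in h
        ... | true rewrite trans (cong R (sym (x⊗[x⁻¹⊗y] y))) (stable x (x⁻¹ ⊗ y) x∈R h) = refl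
        ... | false with R y
        ...   | true = refl
        ...   | false = refl

        split : count R ≡ count R' + count H
        split = trans (∑-cong pointwise) (trans (∑-+ _ _) (cong (count R' +_)
          (∑-bij (x⁻¹ ⊗_) (x ⊗_) x⊗[x⁻¹⊗y] x⁻¹⊗[x⊗y] (λ y → 𝟙 (H y)))))

        -- if x⁻¹ (y h) ∈ H for h ∈ H then x⁻¹ y = (x⁻¹ (y h)) h⁻¹ ∈ H
        coset-shift : ∀ y h → H h ≡ true → H (x⁻¹ ⊗ (y ⊗ h)) ≡ true → H (x⁻¹ ⊗ y) ≡ true
        coset-shift y h h∈H yh∈xH with inverse-closed h h∈H
        ... | h⁻¹ , h⁻¹∈H , h⊗h⁻¹≡ε = subst (λ w → H w ≡ true) cancel (⊗-closed _ h⁻¹ yh∈xH h⁻¹∈H)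
          where
          cancel : (x⁻¹ ⊗ (y ⊗ h)) ⊗ h⁻¹ ≡ x⁻¹ ⊗ y
          cancel = trans (cong (_⊗ h⁻¹) (sym (⊗-assoc x⁻¹ y h)))
                   (trans (⊗-assoc (x⁻¹ ⊗ y) h h⁻¹)
                   (trans (cong ((x⁻¹ ⊗ y) ⊗_) h⊗h⁻¹≡ε) (trans (⊗-comm _ ε) (⊗-identityˡ _))))

        R'-union : IsUnion H R'
        R'-union = record
          { invertible = λ y y∈R' → invertible y (proj₁ (∧-true {R y} y∈R'))
          ; stable = λ y h y∈R' h∈H → let (y∈R , y∉xH) = ∧-true {R y} y∈R' in
              cong₂ _∧_ (stable y h y∈R h∈H) (not-mono (coset-shift y h h∈H) y∉xH) }
          where
          not-mono : ∀ {a b} → (a ≡ true → b ≡ true) → not b ≡ true → not a ≡ true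
          not-mono {true} a⇒b ¬b with a⇒b refl | ¬b
          ... | refl | ()
          not-mono {false} _ _ = refl

      𝟙-pos : ∀ b → 0 < 𝟙 b → b ≡ true
      𝟙-pos true _ = refl

      lagrange : ∀ R → IsUnion H R → count H ∣ count R
      lagrange R R-union = go (count R) R R-union ℕ.≤-refl
        where
        go : ∀ n R → IsUnion H R → count R ≤ n → count H ∣ count R
        go n R R-union |R|≤n with count R in |R|≡
        ... | zero = count H ∣0
        go zero R R-union () | suc k
        go (suc n) R R-union |R|≤n | suc k with ∑-pos (λ x → 𝟙 (R x)) (subst (0 <_) (sym |R|≡) (s≤s z≤n))
        ... | x , x∈R = subst (count H ∣_) (trans (sym split) |R|≡) (∣m∣n⇒∣m+n (go n R' R'-union |R'|≤n) ∣-refl)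
          where
          open RemoveCoset R R-union x (𝟙-pos (R x) x∈R)
          |R'|≤n : count R' ≤ n
          |R'|≤n = ℕ.s≤s⁻¹ (begin
            suc (count R')       ≡⟨ ℕ.+-comm 1 (count R') ⟩
            count R' + 1         ≤⟨ ℕ.+-monoʳ-≤ (count R') |H|≥1 ⟩
            count R' + count H   ≡⟨ trans (sym split) |R|≡ ⟩
            suc k                ≤⟨ |R|≤n ⟩
            suc n                ∎)
            where open ℕ.≤-Reasoning

module IndexArithmetic where

  open import Defs using (_/ₚ_)
  open import Data.Nat as ℕ using (ℕ; zero; suc; NonZero; _≤_; _<_; z≤n; s≤s; _*_; _^_; _/_; ≢-nonZero)
  import Data.Nat.Properties as ℕ
  open import Data.Nat.DivMod using (m*n/n≡m; m/n*n≡m)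
  open import Data.Nat.Divisibility
  open import Data.Nat.GCD using (gcd; gcd[m,n]∣m; gcd[m,n]∣n; gcd[m,n]≢0)
  open import Data.Nat.Coprimality using (coprime-/gcd; coprime-divisor)
  open import Data.Nat.Primality using (Prime; euclidsLemma; prime⇒nonZero)
  open import Data.Nat.Primality.Factorisation using (factorise)
  open import Data.List using ([]; _∷_)
  open import Data.Nat.ListAction using (product)
  open import Data.List.Relation.Unary.All using (_∷_)
  open import Data.Product using (Σ; _×_; _,_; proj₁; proj₂)
  open import Data.Sum using (inj₁; inj₂)
  open import Data.Empty using (⊥-elim)
  open import Relation.Binary.PropositionalEquality
  open import Data.Nat.Tactic.RingSolver using (solve-∀)

  -- A divisor d of L² is a product of two divisors of L: with g = gcd(d, L),
  -- d / g is coprime to L / g and divides (L / g)² g, hence divides L.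
  divisor-of-square : ∀ d L → 0 < L → d ∣ L ^ 2 → Σ ℕ λ a → Σ ℕ λ b → (d ≡ a * b) × (a ∣ L) × (b ∣ L)
  divisor-of-square d L@(suc _) _ d∣L² = g , b , d≡g*b , gcd[m,n]∣n d L , b∣L
    where
    g : ℕ
    g = gcd d L
    instance
      g≢0 : NonZero g
      g≢0 = ≢-nonZero (gcd[m,n]≢0 d L (inj₂ (λ ())))
    b u : ℕ
    b = d / g
    u = L / g
    b*g≡d : b * g ≡ d
    b*g≡d = m/n*n≡m (gcd[m,n]∣m d L)
    u*g≡L : u * g ≡ L
    u*g≡L = m/n*n≡m (gcd[m,n]∣n d L)
    d≡g*b : d ≡ g * b
    d≡g*b = trans (sym b*g≡d) (ℕ.*-comm b g)
    L²≡ : L ^ 2 ≡ u * (u * g) * g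
    L²≡ = trans (cong (L *_) (ℕ.*-identityʳ L)) (trans (cong₂ _*_ (sym u*g≡L) (sym u*g≡L)) (regroup u g))
      where
      regroup : ∀ u g → u * g * (u * g) ≡ u * (u * g) * g
      regroup = solve-∀
    b∣L : b ∣ L
    b∣L = subst (b ∣_) u*g≡L (coprime-divisor (coprime-/gcd d L)
            (*-cancelʳ-∣ g (subst₂ _∣_ (sym b*g≡d) L²≡ d∣L²)))

  prime-divisor : ∀ c → .{{NonZero c}} → c ≢ 1 → Σ ℕ λ q → Prime q × q ∣ c
  prime-divisor c c≢1 with factorise c
  ... | record { factors = [] ; isFactorisation = c≡1 } = ⊥-elim (c≢1 c≡1)
  ... | record { factors = q ∷ qs ; isFactorisation = c≡ ; factorsPrime = q-prime ∷ _ } =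
        q , q-prime , divides (product qs) (trans c≡ (ℕ.*-comm q (product qs)))

  -- The index set of the theorem, for a group of order A L² whose relevant
  -- subgroups have orders c ∣ L² with c ≠ 1.
  module Indices (A L : ℕ) (0<A : 0 < A) (0<L : 0 < L) where

    N : ℕ
    N = A * L ^ 2

    0<N : 0 < N
    0<N = ℕ.*-mono-< 0<A (ℕ.*-mono-< 0<L (ℕ.*-mono-< 0<L (ℕ.n<1+n 0)))

    index-of-divisor : ∀ n c → n * c ≡ N → c ∣ L ^ 2 → c ≢ 1 →
      (0 < n) × (A ∣ n) × (Σ ℕ λ q → Σ (Prime q) λ q-prime → (q ∣ L) × (n ∣ (N /ₚ q) q-prime))
    index-of-divisor n c n*c≡N (divides e L²≡e*c) c≢1 = 0<n , A∣n , q , q-prime , q∣L , n∣N/q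
      where
      0<n : 0 < n
      0<n = ℕ.n≢0⇒n>0 λ n≡0 → ℕ.<⇒≢ 0<N (sym (trans (sym n*c≡N) (cong (_* c) n≡0)))
      instance
        c≢0 : NonZero c
        c≢0 = ≢-nonZero λ c≡0 → ℕ.<⇒≢ 0<N (sym (trans (sym n*c≡N) (trans (cong (n *_) c≡0) (ℕ.*-zeroʳ n))))
      A∣n : A ∣ n
      A∣n = divides e (ℕ.*-cancelʳ-≡ n (e * A) c (trans n*c≡N (trans (cong (A *_) L²≡e*c) (regroup A e c))))
        where
        regroup : ∀ A e c → A * (e * c) ≡ e * A * c
        regroup = solve-∀
      q-divides : Σ ℕ λ q → Prime q × q ∣ c
      q-divides = prime-divisor c c≢1
      q : ℕ
      q = proj₁ q-divides
      q-prime : Prime q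
      q-prime = proj₁ (proj₂ q-divides)
      q∣c : q ∣ c
      q∣c = proj₂ (proj₂ q-divides)
      q∣L : q ∣ L
      q∣L with euclidsLemma L (L * 1) q-prime (∣-trans q∣c (divides e L²≡e*c))
      ... | inj₁ q∣L = q∣L
      ... | inj₂ q∣L*1 = subst (q ∣_) (ℕ.*-identityʳ L) q∣L*1
      n∣N/q : n ∣ (N /ₚ q) q-prime
      n∣N/q with q∣c
      ... | divides c' c≡c'*q = divides c' (trans (cong (λ m → _/_ m q {{prime⇒nonZero q-prime}}) N≡) (m*n/n≡m (c' * n) q {{prime⇒nonZero q-prime}}))
        where
        N≡ : N ≡ c' * n * q
        N≡ = trans (sym n*c≡N) (trans (cong (n *_) c≡c'*q) (regroup n c' q))
          where
          regroup : ∀ n c' q → n * (c' * q) ≡ c' * n * q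
          regroup = solve-∀

    divisor-of-index : ∀ n q (q-prime : Prime q) → A ∣ n → q ∣ L → n ∣ (N /ₚ q) q-prime →
      Σ ℕ λ d → (d ∣ L ^ 2) × (n * d ≡ N) × (2 ≤ d)
    divisor-of-index n q@(suc (suc _)) q-prime (divides k n≡k*A) (divides r L≡r*q) (divides m N/q≡m*n) =
      m * q , d∣L² , n*d≡N , 2≤d
      where
      N≡ : N ≡ A * L * r * q
      N≡ = trans (cong (λ l → A * (l * (l * 1))) L≡r*q) (trans (regroup A r q) (cong (λ l → A * l * r * q) (sym L≡r*q)))
        where
        regroup : ∀ A r q → A * (r * q * (r * q * 1)) ≡ A * (r * q) * r * q
        regroup = solve-∀
      N/q≡ : N / q ≡ A * L * r
      N/q≡ = trans (cong (_/ q) N≡) (m*n/n≡m (A * L * r) q)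
      instance
        A≢0 : NonZero A
        A≢0 = ≢-nonZero (λ A≡0 → ℕ.<⇒≢ 0<A (sym A≡0))
      L*r≡m*k : L * r ≡ m * k
      L*r≡m*k = ℕ.*-cancelˡ-≡ (L * r) (m * k) A (begin
        A * (L * r)      ≡⟨ ℕ.*-assoc A L r ⟨
        A * L * r        ≡⟨ N/q≡ ⟨
        N / q            ≡⟨ N/q≡m*n ⟩
        m * n            ≡⟨ cong (m *_) n≡k*A ⟩
        m * (k * A)      ≡⟨ regroup m k A ⟩
        A * (m * k)      ∎)
        where
        open ≡-Reasoning
        regroup : ∀ m k A → m * (k * A) ≡ A * (m * k)
        regroup = solve-∀
      d∣L² : m * q ∣ L ^ 2
      d∣L² = divides k (begin
        L * (L * 1)      ≡⟨ cong (λ l → L * (l * 1)) L≡r*q ⟩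
        L * (r * q * 1)  ≡⟨ regroup L r q ⟩
        L * r * q        ≡⟨ cong (_* q) L*r≡m*k ⟩
        m * k * q        ≡⟨ regroup′ m k q ⟩
        k * (m * q)      ∎)
        where
        open ≡-Reasoning
        regroup : ∀ L r q → L * (r * q * 1) ≡ L * r * q
        regroup = solve-∀
        regroup′ : ∀ m k q → m * k * q ≡ k * (m * q)
        regroup′ = solve-∀
      n*d≡N : n * (m * q) ≡ N
      n*d≡N = begin
        n * (m * q)      ≡⟨ cong (_* (m * q)) n≡k*A ⟩
        k * A * (m * q)  ≡⟨ regroup k A m q ⟩
        A * (m * k) * q  ≡⟨ cong (λ w → A * w * q) L*r≡m*k ⟨
        A * (L * r) * q  ≡⟨ cong (_* q) (ℕ.*-assoc A L r) ⟨
        A * L * r * q    ≡⟨ N≡ ⟨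
        N                ∎
        where
        open ≡-Reasoning
        regroup : ∀ k A m q → k * A * (m * q) ≡ A * (m * k) * q
        regroup = solve-∀
      2≤d : 2 ≤ m * q
      2≤d = at-least-two m L*r≡m*k
        where
        -- m = 0 would force L r = 0, but L and r = L / q are positive
        at-least-two : ∀ m → L * r ≡ m * k → 2 ≤ m * q
        at-least-two (suc m') _ = ℕ.≤-trans (s≤s (s≤s z≤n)) (ℕ.m≤m+n q (m' * q))
        at-least-two zero L*r≡0 with ℕ.m*n≡0⇒m≡0∨n≡0 L L*r≡0
        ... | inj₁ L≡0 = ⊥-elim (ℕ.<⇒≢ 0<L (sym L≡0))
        ... | inj₂ r≡0 = ⊥-elim (ℕ.<⇒≢ 0<L (sym (trans L≡r*q (cong (_* q) r≡0))))

module CsSubgroups where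

  open import Defs
  open FiniteSums
  open MatrixSums
  open PrimeFields
  open Powers
  open Polynomials
  open GeneralLinear
  open Matrices
  open Cosets
  open import Data.Nat as ℕ using (ℕ; zero; suc; NonZero; _∸_; _≤_; _<_; z≤n; s≤s; _+_; _*_; _^_)
  import Data.Nat.Properties as ℕ
  open import Data.Nat.Divisibility using (_∣_)
  open import Data.Nat.Primality using (Prime)
  open import Data.Fin as Fin using (Fin)
  import Data.Fin.Properties as Fin
  open import Data.Product using (Σ; _×_; _,_; proj₁; proj₂)
  open import Data.Sum using (_⊎_; inj₁; inj₂)
  open import Data.Bool using (Bool; true; false; _∧_; not)
  open import Data.Empty using (⊥-elim)
  open import Relation.Binary.PropositionalEquality
  open import Relation.Nullary using (Dec; yes; no; ¬_; does; _×-dec_)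
  open import Function using (_∘_)
  open import Relation.Nullary.Decidable using (dec-true)

  conjugate-by-I : ∀ p .{{_ : NonZero p}} (p-prime : Prime p) (Pr : Mat p → Set) (G : Subgroup p) →
    (∀ M → mem G M ≡ true → Pr M) → ConjugateInto p Pr G
  conjugate-by-I p p-prime Pr G all-Pr = I₂ , I₂ , isGL-I , ∙-identityˡ I₂ , ∙-identityˡ I₂ ,
    λ M M∈G → subst Pr (sym (trans (cong (_∙ I₂) (∙-identityˡ M)) (∙-identityʳ M))) (all-Pr M M∈G)
    where
    open MatrixAlgebra p
    open GL2Order p p-prime using (isGL-I)

  module Torus (p : ℕ) .{{_ : NonZero p}} (p-prime : Prime p) where

    open PrimeField p p-prime
    open Enumerations p

    infixl 7 _⊗_
    _⊗_ : F × F → F × F → F × F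
    (a , d) ⊗ (a' , d') = (a *' a' , d *' d')

    one : F × F
    one = (1' , 1')

    ⊗-assoc : ∀ x y z → x ⊗ y ⊗ z ≡ x ⊗ (y ⊗ z)
    ⊗-assoc (a , b) (c , d) (e , f) = cong₂ _,_ (*-assoc a c e) (*-assoc b d f)

    ⊗-comm : ∀ x y → x ⊗ y ≡ y ⊗ x
    ⊗-comm (a , b) (c , d) = cong₂ _,_ (*-comm a c) (*-comm b d)

    ⊗-identityˡ : ∀ x → one ⊗ x ≡ x
    ⊗-identityˡ (a , b) = cong₂ _,_ (*-identityˡ a) (*-identityˡ b)

    open Lagrange enumF² _⊗_ one ⊗-assoc ⊗-comm ⊗-identityˡ public

    nonzero : F → Bool
    nonzero a = not (does (a Fin.≟ 0'))

    nonzero⇒≢0 : ∀ a → nonzero a ≡ true → a ≢ 0'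
    nonzero⇒≢0 a e with a Fin.≟ 0'
    nonzero⇒≢0 a () | yes _
    ... | no a≢0 = a≢0

    ≢0⇒nonzero : ∀ a → a ≢ 0' → nonzero a ≡ true
    ≢0⇒nonzero a a≢0 with a Fin.≟ 0'
    ... | yes a≡0 = ⊥-elim (a≢0 a≡0)
    ... | no _ = refl

    unit : F × F → Bool
    unit (a , d) = nonzero a ∧ nonzero d

    count-nonzero : ∑Fin p (𝟙 ∘ nonzero) ≡ p ∸ 1
    count-nonzero = ℕ.+-cancelʳ-≡ 1 _ _ (begin
      ∑Fin p (𝟙 ∘ nonzero) + 1             ≡⟨ Enumerable.∑-split enumF (𝟙 ∘ nonzero) 0' 0 1 at-0 elsewhere ⟩
      ∑Fin p (λ _ → 1)                     ≡⟨ trans (∑Fin-const p 1) (ℕ.*-identityʳ p) ⟩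
      p                                    ≡⟨ ℕ.m∸n+n≡m {p} {1} (ℕ.<⇒≤ 1<p) ⟨
      p ∸ 1 + 1                            ∎)
      where
      open ≡-Reasoning
      at-0 : 𝟙 (nonzero 0') ≡ 0
      at-0 with 0' Fin.≟ 0'
      ... | yes _ = refl
      ... | no 0≢0 = ⊥-elim (0≢0 refl)
      elsewhere : ∀ a → a ≢ 0' → 𝟙 (nonzero a) ≡ 1
      elsewhere a a≢0 = cong 𝟙 (≢0⇒nonzero a a≢0)

    count-units : Enumerable.count enumF² unit ≡ (p ∸ 1) ^ 2
    count-units = begin
      ∑Fin p (λ a → ∑Fin p (λ d → 𝟙 (nonzero a ∧ nonzero d)))
        ≡⟨ ∑-cong (λ a → trans (∑-cong (λ d → 𝟙-∧ (nonzero a) (nonzero d))) (∑-*ˡ (𝟙 (nonzero a)) _)) ⟩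
      ∑Fin p (λ a → 𝟙 (nonzero a) * ∑Fin p (𝟙 ∘ nonzero))
        ≡⟨ ∑-cong (λ a → ℕ.*-comm (𝟙 (nonzero a)) _) ⟩
      ∑Fin p (λ a → ∑Fin p (𝟙 ∘ nonzero) * 𝟙 (nonzero a))
        ≡⟨ ∑-*ˡ (∑Fin p (𝟙 ∘ nonzero)) _ ⟩
      ∑Fin p (𝟙 ∘ nonzero) * ∑Fin p (𝟙 ∘ nonzero)
        ≡⟨ cong₂ _*_ count-nonzero (trans count-nonzero (sym (ℕ.*-identityʳ (p ∸ 1)))) ⟩
      (p ∸ 1) ^ 2 ∎
      where
      open ≡-Reasoning
      open Enumerable enumF using (∑-cong; ∑-*ˡ)

    units-union : ∀ H → IsSubgroup H → IsUnion H unit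
    units-union H H-subgroup = record { invertible = invertible ; stable = stable }
      where
      open IsSubgroup H-subgroup
      invertible : ∀ x → unit x ≡ true → Σ (F × F) λ y → x ⊗ y ≡ one
      invertible (a , d) a,d∈U with ∧-true {nonzero a} a,d∈U
      ... | a≢0 , d≢0 with inverse a (nonzero⇒≢0 a a≢0) | inverse d (nonzero⇒≢0 d d≢0)
      ...   | a⁻¹ , a*a⁻¹ | d⁻¹ , d*d⁻¹ = (a⁻¹ , d⁻¹) , cong₂ _,_ a*a⁻¹ d*d⁻¹
      stable : ∀ x h → unit x ≡ true → H h ≡ true → unit (x ⊗ h) ≡ true
      stable (a , d) (a' , d') a,d∈U h∈H with ∧-true {nonzero a} a,d∈U | inverse-closed (a' , d') h∈H
      ... | a≢0 , d≢0 | (a'' , d'') , _ , h⊗h⁻¹≡one =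
        cong₂ _∧_ (≢0⇒nonzero _ (*-nonzero a a' (nonzero⇒≢0 a a≢0) (invertible⇒nonzero a' a'' (cong proj₁ h⊗h⁻¹≡one))))
                  (≢0⇒nonzero _ (*-nonzero d d' (nonzero⇒≢0 d d≢0) (invertible⇒nonzero d' d'' (cong proj₂ h⊗h⁻¹≡one))))

  -- A subgroup G conjugate into the diagonal matrices is isomorphic to the
  -- subgroup H = {(a, d) | P diag(a, d) P⁻¹ ∈ G} of the torus; hence by
  -- Lagrange |G| divides (p - 1)².
  module DiagonalizableOrder (p : ℕ) .{{_ : NonZero p}} (p-prime : Prime p)
      (G : Subgroup p) (diagonalizable : ConjugateInto p (IsDiagonal p) G) where

    open PrimeField p p-prime
    open Enumerations p
    open MatrixAlgebra p
    open Torus p p-prime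

    P Q : Mat p
    P = proj₁ diagonalizable
    Q = proj₁ (proj₂ diagonalizable)
    P∙Q≡I : P ∙ Q ≡ I₂
    P∙Q≡I = proj₁ (proj₂ (proj₂ (proj₂ diagonalizable)))
    Q∙P≡I : Q ∙ P ≡ I₂
    Q∙P≡I = proj₁ (proj₂ (proj₂ (proj₂ (proj₂ diagonalizable))))
    conjugate-diagonal : ∀ M → mem G M ≡ true → IsDiagonal p (Q ∙ M ∙ P)
    conjugate-diagonal = proj₂ (proj₂ (proj₂ (proj₂ (proj₂ diagonalizable))))

    σ τ : Mat p → Mat p
    σ M = P ∙ M ∙ Q
    τ M = Q ∙ M ∙ P

    σ∈G⇒diagonal : ∀ M → mem G (σ M) ≡ true → IsDiagonal p M
    σ∈G⇒diagonal M e = subst (IsDiagonal p) (conj-cancel Q P M Q∙P≡I) (conjugate-diagonal (σ M) e)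

    H : F × F → Bool
    H (a , d) = mem G (σ (diag a d))

    off-diagonal-b : ∀ a b c d → b ≢ 0' → 𝟙 (mem G (σ (mat a b c d))) ≡ 0
    off-diagonal-b a b c d b≢0 with mem G (σ (mat a b c d)) in e
    ... | true = ⊥-elim (b≢0 (proj₁ (σ∈G⇒diagonal (mat a b c d) e)))
    ... | false = refl

    off-diagonal-c : ∀ a c d → c ≢ 0' → 𝟙 (mem G (σ (mat a 0' c d))) ≡ 0
    off-diagonal-c a c d c≢0 with mem G (σ (mat a 0' c d)) in e
    ... | true = ⊥-elim (c≢0 (proj₂ (σ∈G⇒diagonal (mat a 0' c d) e)))
    ... | false = refl

    |G|≡|H| : card p (mem G) ≡ Enumerable.count enumF² H
    |G|≡|H| = begin
      card p (mem G)                       ≡⟨ card≡count (mem G) ⟩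
      ∑Mat (𝟙 ∘ mem G)                     ≡⟨ Enumerable.∑-bij enumMat σ τ (λ M → conj-cancel Q P M Q∙P≡I) (λ M → conj-cancel P Q M P∙Q≡I) _ ⟨
      ∑Mat (𝟙 ∘ mem G ∘ σ)                 ≡⟨ ∑-cong (λ a → trans
          (∑-single _ 0' (λ b b≢0 → ∑-zero _ (λ c → ∑-zero _ (λ d → off-diagonal-b a b c d b≢0))))
          (∑-single _ 0' (λ c c≢0 → ∑-zero _ (λ d → off-diagonal-c a c d c≢0)))) ⟩
      Enumerable.count enumF² H            ∎
      where
      open ≡-Reasoning
      open Enumerable enumF using (∑-cong; ∑-single; ∑-zero)

    H-inverse : ∀ x → H x ≡ true → Σ (F × F) λ y → (H y ≡ true) × (x ⊗ y ≡ one)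
    H-inverse (a , d) e with closed⁻¹ G (σ (diag a d)) e
    ... | N , N∈G , σD∙N≡I with conjugate-diagonal N N∈G
    ... | τN-b≡0 , τN-c≡0 = (a' , d') , τN∈H , cong₂ _,_ (cong Mat.a D∙D'≡I) (cong Mat.d D∙D'≡I)
      where
      open ≡-Reasoning
      a' d' : F
      a' = Mat.a (τ N)
      d' = Mat.d (τ N)
      τN≡ : τ N ≡ diag a' d'
      τN≡ = mat≡ refl τN-b≡0 τN-c≡0 refl
      τN∈H : mem G (σ (diag a' d')) ≡ true
      τN∈H = subst (λ w → mem G w ≡ true) (sym (trans (cong σ (sym τN≡)) (conj-cancel P Q N P∙Q≡I))) N∈G
      D∙D'≡I : diag (a *' a') (d *' d') ≡ I₂
      D∙D'≡I = begin
        diag (a *' a') (d *' d')       ≡⟨ diag-∙ a d a' d' ⟨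
        diag a d ∙ diag a' d'          ≡⟨ cong₂ _∙_ (sym (conj-cancel Q P (diag a d) Q∙P≡I)) (sym τN≡) ⟩
        τ (σ (diag a d)) ∙ τ N         ≡⟨ conj-∙ Q P (σ (diag a d)) N P∙Q≡I ⟩
        τ (σ (diag a d) ∙ N)           ≡⟨ cong τ σD∙N≡I ⟩
        Q ∙ I₂ ∙ P                     ≡⟨ cong (_∙ P) (∙-identityʳ Q) ⟩
        Q ∙ P                          ≡⟨ Q∙P≡I ⟩
        I₂                             ∎

    H-subgroup : IsSubgroup H
    H-subgroup = record
      { ε∈ = subst (λ w → mem G w ≡ true) (sym (trans (cong (_∙ Q) (∙-identityʳ P)) P∙Q≡I)) (has-I G)
      ; ⊗-closed = λ { (a , d) (a' , d') e e' → subst (λ w → mem G w ≡ true)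
            (trans (conj-∙ P Q (diag a d) (diag a' d') Q∙P≡I) (cong σ (diag-∙ a d a' d'))) (closed· G _ _ e e') }
      ; inverse-closed = H-inverse }

    order-divides : card p (mem G) ∣ (p ∸ 1) ^ 2
    order-divides = subst₂ _∣_ (sym |G|≡|H|) count-units (lagrange H H-subgroup unit (units-union H H-subgroup))

  -- a subgroup of order 1 is {I}, which is scalar
  order≢1 : ∀ p .{{_ : NonZero p}} (p-prime : Prime p) (G : Subgroup p) →
    ¬ ConjugateInto p (IsScalar p) G → card p (mem G) ≢ 1
  order≢1 p p-prime G not-scalar |G|≡1 = not-scalar (conjugate-by-I p p-prime (IsScalar p) G trivial)
    where
    open Enumerations p
    trivial : ∀ M → mem G M ≡ true → IsScalar p M
    trivial M M∈G = subst (IsScalar p) (sym (Enumerable.count≡1⇒unique enumMat (mem G) (I p) M (has-I G) M∈G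
                      (trans (sym (card≡count (mem G))) |G|≡1))) (refl , refl , refl)

  module DiagonalRootsOfUnity (p : ℕ) .{{_ : NonZero p}} (p-prime : Prime p) (a' b' : ℕ) where

    open PrimeField p p-prime
    open Fermat p p-prime
    open RootsOfUnity p p-prime using (μ-count)
    open Enumerations p
    open MatrixAlgebra p
    open GL2Order p p-prime using (det≢0⇒isGL)

    a b : ℕ
    a = suc a'
    b = suc b'

    Member : Mat p → Set
    Member (mat x y z w) = (y ≡ 0') × (z ≡ 0') × (x ^' a ≡ 1') × (w ^' b ≡ 1')

    member? : ∀ M → Dec (Member M)
    member? (mat x y z w) = (y Fin.≟ 0') ×-dec ((z Fin.≟ 0') ×-dec ((x ^' a Fin.≟ 1') ×-dec (w ^' b Fin.≟ 1')))

    diag-member : ∀ x w → x ^' a ≡ 1' → w ^' b ≡ 1' → does (member? (diag x w)) ≡ true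
    diag-member x w xᵃ≡1 wᵇ≡1 = dec-true (member? (diag x w)) (refl , refl , xᵃ≡1 , wᵇ≡1)

    member⇒diag : ∀ x y z w → Member (mat x y z w) → mat x y z w ≡ diag x w
    member⇒diag x y z w (y≡0 , z≡0 , _) = mat≡ refl y≡0 z≡0 refl

    root≢0 : ∀ x k → x ^' suc k ≡ 1' → x ≢ 0'
    root≢0 x k xᵏ⁺¹≡1 x≡0 = 1≢0 (trans (sym xᵏ⁺¹≡1) (trans (cong (_^' suc k) x≡0) (0^n≡0 k)))

    inverse-root : ∀ x k → x ^' suc k ≡ 1' → (x ^' k) ^' suc k ≡ 1'
    inverse-root x k xᵏ⁺¹≡1 = begin
      (x ^' k) ^' suc k      ≡⟨ ^-assocʳ x k (suc k) ⟩
      x ^' (k * suc k)       ≡⟨ cong (x ^'_) (ℕ.*-comm k (suc k)) ⟩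
      x ^' (suc k * k)       ≡⟨ ^-assocʳ x (suc k) k ⟨
      (x ^' suc k) ^' k      ≡⟨ cong (_^' k) xᵏ⁺¹≡1 ⟩
      1' ^' k                ≡⟨ 1^n≡1 k ⟩
      1'                     ∎
      where open ≡-Reasoning

    root-product : ∀ x x' n → x ^' n ≡ 1' → x' ^' n ≡ 1' → (x *' x') ^' n ≡ 1'
    root-product x x' n xⁿ≡1 x'ⁿ≡1 = trans (^-distrib-* x x' n) (trans (cong₂ _*'_ xⁿ≡1 x'ⁿ≡1) (*-identityˡ 1'))

    μ×μ : Subgroup p
    μ×μ = record
      { mem = λ M → does (member? M)
      ; ⊆GL = λ { (mat x y z w) e → invertible x y z w (does⇒ (member? (mat x y z w)) e) }
      ; has-I = diag-member 1' 1' (1^n≡1 a) (1^n≡1 b)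
      ; closed· = λ { (mat x y z w) (mat x' y' z' w') e e' → closed x y z w x' y' z' w'
            (does⇒ (member? (mat x y z w)) e) (does⇒ (member? (mat x' y' z' w')) e') }
      ; closed⁻¹ = λ { (mat x y z w) e → inverse-member x y z w (does⇒ (member? (mat x y z w)) e) } }
      where
      invertible : ∀ x y z w → Member (mat x y z w) → isGL p (mat x y z w) ≡ true
      invertible x y z w (y≡0 , z≡0 , xᵃ≡1 , wᵇ≡1) = det≢0⇒isGL (mat x y z w) λ det≡0 →
        *-nonzero x w (root≢0 x a' xᵃ≡1) (root≢0 w b' wᵇ≡1)
          (trans (x-y≡0⇒x≡y (x *' w) (y *' z) det≡0) (trans (cong₂ _*'_ y≡0 z≡0) (zeroˡ 0')))
      closed : ∀ x y z w x' y' z' w' → Member (mat x y z w) → Member (mat x' y' z' w') →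
               does (member? (mat x y z w ∙ mat x' y' z' w')) ≡ true
      closed x y z w x' y' z' w' m@(_ , _ , xᵃ≡1 , wᵇ≡1) m'@(_ , _ , x'ᵃ≡1 , w'ᵇ≡1) =
        subst (λ M → does (member? M) ≡ true)
          (sym (trans (cong₂ _∙_ (member⇒diag x y z w m) (member⇒diag x' y' z' w' m')) (diag-∙ x w x' w')))
          (diag-member (x *' x') (w *' w') (root-product x x' a xᵃ≡1 x'ᵃ≡1) (root-product w w' b wᵇ≡1 w'ᵇ≡1))
      inverse-member : ∀ x y z w → Member (mat x y z w) →
        Σ (Mat p) λ N → (does (member? N) ≡ true) × (mat x y z w ∙ N ≡ I₂)
      inverse-member x y z w m@(_ , _ , xᵃ≡1 , wᵇ≡1) =
        diag (x ^' a') (w ^' b') ,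
        diag-member (x ^' a') (w ^' b') (inverse-root x a' xᵃ≡1) (inverse-root w b' wᵇ≡1) ,
        trans (cong (_∙ diag (x ^' a') (w ^' b')) (member⇒diag x y z w m)) (trans (diag-∙ x w _ _) (mat≡ xᵃ≡1 refl refl wᵇ≡1))

    μ×μ-diagonal : ConjugateInto p (IsDiagonal p) μ×μ
    μ×μ-diagonal = conjugate-by-I p p-prime (IsDiagonal p) μ×μ diagonal
      where
      diagonal : ∀ M → does (member? M) ≡ true → IsDiagonal p M
      diagonal (mat x y z w) e with does⇒ (member? (mat x y z w)) e
      ... | y≡0 , z≡0 , _ = y≡0 , z≡0

    roots : F → F → ℕ
    roots x w = χ (x ^' a Fin.≟ 1') * χ (w ^' b Fin.≟ 1')

    member-count : ∀ x y z w → 𝟙 (does (member? (mat x y z w))) ≡ χ (y Fin.≟ 0') * (χ (z Fin.≟ 0') * roots x w)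
    member-count x y z w =
      trans (𝟙-does (member? (mat x y z w)))
      (trans (χ-×-dec (y Fin.≟ 0') _) (cong (χ (y Fin.≟ 0') *_)
      (trans (χ-×-dec (z Fin.≟ 0') _) (cong (χ (z Fin.≟ 0') *_) (χ-×-dec (x ^' a Fin.≟ 1') _)))))

    μ×μ-order : card p (mem μ×μ) ≡ μ-count a * μ-count b
    μ×μ-order = begin
      card p (mem μ×μ)                     ≡⟨ card≡count (mem μ×μ) ⟩
      ∑Mat (λ M → 𝟙 (does (member? M)))   ≡⟨ ∑-cong (λ x → trans
          (∑-single _ 0' (λ y y≢0 → ∑-zero _ (λ z → ∑-zero _ (λ w → trans (member-count x y z w) (cong (_* _) (χ-no (y Fin.≟ 0') y≢0))))))
          (∑-single _ 0' (λ z z≢0 → ∑-zero _ (λ w → trans (member-count x 0' z w)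
             (trans (cong (_* (χ (z Fin.≟ 0') * roots x w)) (χ-yes (0' Fin.≟ 0') refl))
             (trans (ℕ.+-identityʳ (χ (z Fin.≟ 0') * roots x w)) (cong (_* roots x w) (χ-no (z Fin.≟ 0') z≢0)))))))) ⟩
      ∑Fin p (λ x → ∑Fin p (λ w → 𝟙 (does (member? (diag x w)))))
                                           ≡⟨ ∑-cong (λ x → ∑-cong (λ w → diagonal-term x w)) ⟩
      ∑Fin p (λ x → ∑Fin p (λ w → χ (x ^' a Fin.≟ 1') * χ (w ^' b Fin.≟ 1')))
                                           ≡⟨ ∑-cong (λ x → ∑-*ˡ (χ (x ^' a Fin.≟ 1')) _) ⟩
      ∑Fin p (λ x → χ (x ^' a Fin.≟ 1') * μ-count b)
                                           ≡⟨ ∑-cong (λ x → ℕ.*-comm (χ (x ^' a Fin.≟ 1')) (μ-count b)) ⟩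
      ∑Fin p (λ x → μ-count b * χ (x ^' a Fin.≟ 1'))
                                           ≡⟨ ∑-*ˡ (μ-count b) _ ⟩
      μ-count b * μ-count a                ≡⟨ ℕ.*-comm (μ-count b) (μ-count a) ⟩
      μ-count a * μ-count b                ∎
      where
      open ≡-Reasoning
      open Enumerable enumF using (∑-cong; ∑-single; ∑-zero; ∑-*ˡ)
      diagonal-term : ∀ x w → 𝟙 (does (member? (diag x w))) ≡ roots x w
      diagonal-term x w = trans (member-count x 0' 0' w)
        (trans (cong₂ (λ u v → u * (v * roots x w)) (χ-yes (0' Fin.≟ 0') refl) (χ-yes (0' Fin.≟ 0') refl))
               (trans (ℕ.+-identityʳ (1 * roots x w)) (ℕ.+-identityʳ (roots x w))))

    -- a root of unity other than 1 gives a non-scalar diagonal element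
    μ×μ-not-scalar : (2 ≤ μ-count a) ⊎ (2 ≤ μ-count b) → ¬ ConjugateInto p (IsScalar p) μ×μ
    μ×μ-not-scalar (inj₁ 2≤|μₐ|) (P , Q , _ , P∙Q≡I , _ , scalar) with Enumerable.two-points enumF (λ x → x ^' a Fin.≟ 1') 1' 2≤|μₐ|
    ... | x , xᵃ≡1 , x≢1 = x≢1 (conj-scalar P Q (diag x 1') P∙Q≡I (scalar (diag x 1') (diag-member x 1' xᵃ≡1 (1^n≡1 b))))
    μ×μ-not-scalar (inj₂ 2≤|μ_b|) (P , Q , _ , P∙Q≡I , _ , scalar) with Enumerable.two-points enumF (λ w → w ^' b Fin.≟ 1') 1' 2≤|μ_b|
    ... | w , wᵇ≡1 , w≢1 = w≢1 (sym (conj-scalar P Q (diag 1' w) P∙Q≡I (scalar (diag 1' w) (diag-member 1' w (1^n≡1 a) wᵇ≡1))))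

  Cs-order : ∀ p .{{_ : NonZero p}} (p-prime : Prime p) (G : Subgroup p) → BelongsToCs p G →
    (card p (mem G) ∣ (p ∸ 1) ^ 2) × (card p (mem G) ≢ 1)
  Cs-order p p-prime G (diagonalizable , not-scalar) =
    DiagonalizableOrder.order-divides p p-prime G diagonalizable , order≢1 p p-prime G not-scalar

  Cs-subgroup-of-order : ∀ p .{{_ : NonZero p}} (p-prime : Prime p) a b → a ∣ p ∸ 1 → b ∣ p ∸ 1 → 2 ≤ a * b →
    Σ (Subgroup p) λ G → BelongsToCs p G × (card p (mem G) ≡ a * b)
  Cs-subgroup-of-order p p-prime zero b _ _ ()
  Cs-subgroup-of-order p p-prime (suc a') zero _ _ 2≤a*0 = ⊥-elim (2≰0 (subst (2 ≤_) (ℕ.*-zeroʳ (suc a')) 2≤a*0))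
    where
    2≰0 : ¬ 2 ≤ 0
    2≰0 ()
  Cs-subgroup-of-order p p-prime (suc a') (suc b') a∣p-1 b∣p-1 2≤ab =
    μ×μ , (μ×μ-diagonal , μ×μ-not-scalar (subst₂ (λ u v → 2 ≤ u ⊎ 2 ≤ v) (sym |μₐ|≡a) (sym |μ_b|≡b) (two≤ a' b' 2≤ab))) ,
    trans μ×μ-order (cong₂ _*_ |μₐ|≡a |μ_b|≡b)
    where
    open DiagonalRootsOfUnity p p-prime a' b'
    open RootsOfUnity p p-prime using (μ-count; μ-count-divisor)
    |μₐ|≡a : μ-count (suc a') ≡ suc a'
    |μₐ|≡a = μ-count-divisor (suc a') a∣p-1
    |μ_b|≡b : μ-count (suc b') ≡ suc b'
    |μ_b|≡b = μ-count-divisor (suc b') b∣p-1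
    two≤ : ∀ a' b' → 2 ≤ suc a' * suc b' → 2 ≤ suc a' ⊎ 2 ≤ suc b'
    two≤ (suc _) _ _ = inj₁ (s≤s (s≤s z≤n))
    two≤ zero (suc _) _ = inj₂ (s≤s (s≤s z≤n))
    two≤ zero zero (s≤s ())

open GeneralLinear
open IndexArithmetic
open CsSubgroups
open import Data.Nat using (_≤_; nonTrivial⇒n>1)
open import Data.Nat.Properties using (m<n⇒0<n∸m; *-mono-<; <-trans; n<1+n; m≤n+m)
open import Data.Nat.Primality using (prime⇒nonTrivial)
open import Data.Product using (_,_)
open import Function.Bundles using (mk⇔)
open import Relation.Binary.PropositionalEquality using (_≡_; trans; sym; cong; subst)

-- The argument does not use that ℓ is odd.
lemma3p5 : (ℓ : ℕ) .{{_ : NonZero ℓ}} → Prime ℓ → ℓ ≢ 2 → (n : ℕ) →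
    (Σ (Subgroup ℓ) λ G → BelongsToCs ℓ G × HasIndex ℓ G n)
    ⇔ ((0 < n) × (ℓ * (ℓ + 1) ∣ n) ×
       (Σ ℕ λ q → Σ (Prime q) λ pq →
          (q ∣ ℓ ∸ 1) × (n ∣ ((ℓ * (ℓ + 1) * (ℓ ∸ 1) ^ 2) /ₚ q) pq)))
lemma3p5 ℓ ℓ-prime _ n = mk⇔
  (λ { (G , G∈Cs , index) →
    let (|G|∣L² , |G|≢1) = Cs-order ℓ ℓ-prime G G∈Cs
    in index-of-divisor n (card ℓ (mem G)) (trans index card-GL) |G|∣L² |G|≢1 })
  (λ { (_ , A∣n , q , q-prime , q∣L , n∣N/q) →
    let (d , d∣L² , n*d≡N , 2≤d) = divisor-of-index n q q-prime A∣n q∣L n∣N/q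
        (a , b , d≡a*b , a∣L , b∣L) = divisor-of-square d (ℓ ∸ 1) 0<L d∣L²
        (G , G∈Cs , |G|≡a*b) = Cs-subgroup-of-order ℓ ℓ-prime a b a∣L b∣L (subst (2 ≤_) d≡a*b 2≤d)
    in G , G∈Cs , trans (cong (n *_) (trans |G|≡a*b (sym d≡a*b))) (trans n*d≡N (sym card-GL)) })
  where
  1<ℓ : 1 < ℓ
  1<ℓ = nonTrivial⇒n>1 ℓ {{prime⇒nonTrivial ℓ-prime}}
  0<L : 0 < ℓ ∸ 1
  0<L = m<n⇒0<n∸m 1<ℓ
  open GL2Order ℓ ℓ-prime using (card-GL)
  open Indices (ℓ * (ℓ + 1)) (ℓ ∸ 1) (*-mono-< (<-trans (n<1+n 0) 1<ℓ) (m≤n+m 1 ℓ)) 0<L
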